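{- For all $n\ge1$ and $k\ge0$, the dimension of the homogeneous component of degree $k$ of $\mathbb{Q}\langle X_n\rangle/\langle\mathrm{NCSym}_n^+\rangle$ equals $n^k-\sum_{i=1}^{k}w_{i,n}\,n^{k-i}$, where $w_{i,n}$ is the number of nonsplitable set partitions of $[i]$ with at most $n$ blocks.
   Context: $X_n=\{x_1,\dots,x_n\}$, $\mathbb{Q}\langle X_n\rangle$ the free associative algebra graded by degree. For a set partition $A$ of $[m]$, $\mathbf{m}_A[X_n]=\sum x_{i_1}\cdots x_{i_m}$ over sequences in $[n]^m$ with $i_a=i_b$ iff $a,b$ lie in the same block of $A$; $\mathrm{NCSym}_n$ is their span. $\langle\mathrm{NCSym}_n^+\rangle$ is the left ideal generated by elements of $\mathrm{NCSym}_n$ without constant term. Blocks of a set partition $A\vdash[n']$ are listed $A_1,\dots,A_k$ by increasing minimum. For $A\vdash[n']$ with $k$ blocks and $B\vdash[m]$ with $\ell$ blocks, $A\circ B\vdash[n'+m]$ is obtained by taking the blocks $A_i\cup(B_i+n')$ for $i\le\min(k,\ell)$ together with the remaining unpaired blocks $A_i$ ($i>\ell$) or $B_i+n'$ ($i>k$), where $S+n'=\{s+n':s\in S\}$. A nonempty set partition $A$ is nonsplitable if there are no nonempty set partitions $B,C$ with $A=B\circ C$. -}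

module Defs where

open import Data.Nat as ℕ using (ℕ; zero; suc; _≤_; _<_; _⊔_; _^_; _∸_; _≡ᵇ_)
open import Data.Fin as Fin using (Fin)
open import Data.Bool using (Bool; true; false; if_then_else_; _∧_)
open import Data.List using (List; []; _∷_; _++_; map; concatMap; allFin; foldr; length; zip)
open import Data.List.Properties using (≡-dec)
open import Data.List.Relation.Unary.All using (All)
open import Data.List.Relation.Unary.Unique.Propositional using (Unique)
open import Data.List.Membership.Propositional using (_∈_)
open import Data.Rational as ℚ using (ℚ; 0ℚ; 1ℚ)
open import Data.Product using (Σ; Σ-syntax; _×_; _,_; ∃)
open import Data.Unit using (⊤)
open import Relation.Nullary using (¬_; ⌊_⌋)
open import Relation.Binary.PropositionalEquality using (_≡_; _≢_)

-- A set partition A of [m] is a list of length m whose a-th entry is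
-- the index (0-based) of the block containing a, blocks being numbered
-- A_1, A_2, ... by increasing minimum (the paper's convention).
-- This forces the restricted growth condition below.

-- IsRGSFrom k xs : labels 0..k-1 have already been used.
IsRGSFrom : ℕ → List ℕ → Set
IsRGSFrom k []       = ⊤
IsRGSFrom k (x ∷ xs) = (x ≤ k) × IsRGSFrom (k ⊔ suc x) xs

IsSetPartition : List ℕ → Set
IsSetPartition = IsRGSFrom 0

SetPartition : Set
SetPartition = Σ (List ℕ) IsSetPartition

numBlocks : List ℕ → ℕ
numBlocks = foldr (λ x acc → suc x ⊔ acc) 0

-- A ∘ B for A ⊢ [n'] and B ⊢ [m]: blocks A_i ∪ (B_i + n'), plus the
-- unpaired blocks.  In the block-index encoding, position n'+b lies in
-- the block with index (label of b in B), so A ∘ B is concatenation.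
_∘ₚ_ : List ℕ → List ℕ → List ℕ
A ∘ₚ B = A ++ B

Nonsplitable : List ℕ → Set
Nonsplitable A =
  IsSetPartition A × (1 ≤ length A) ×
  ¬ (Σ[ B ∈ List ℕ ] Σ[ C ∈ List ℕ ]
       IsSetPartition B × (1 ≤ length B) ×
       IsSetPartition C × (1 ≤ length C) × (A ≡ B ∘ₚ C))

HasCount : (List ℕ → Set) → ℕ → Set
HasCount P c =
  Σ[ L ∈ List (List ℕ) ] Unique L × (length L ≡ c) ×
    (∀ A → (A ∈ L → P A) × (P A → A ∈ L))

NSP : ℕ → ℕ → List ℕ → Set
NSP n i A = Nonsplitable A × (length A ≡ i) × (numBlocks A ≤ n)

-- The free associative algebra ℚ⟨X_n⟩: noncommutative polynomials as
-- finite formal sums of (coefficient, word); words are List (Fin n).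

Word : ℕ → Set
Word n = List (Fin n)

Poly : ℕ → Set
Poly n = List (ℚ × Word n)

coeff : ∀ {n} → Poly n → Word n → ℚ
coeff []             w = 0ℚ
coeff ((c , u) ∷ p) w = (if ⌊ ≡-dec Fin._≟_ u w ⌋ then c else 0ℚ) ℚ.+ coeff p w

scale : ∀ {n} → ℚ → Poly n → Poly n
scale q = map (λ { (c , u) → (q ℚ.* c , u) })

_⊕_ : ∀ {n} → Poly n → Poly n → Poly n
p ⊕ q = p ++ q

_⊗_ : ∀ {n} → Poly n → Poly n → Poly n
p ⊗ q = concatMap (λ { (c , u) → map (λ { (d , v) → (c ℚ.* d , u ++ v) }) q }) p

allWords : ∀ n → ℕ → List (Word n)
allWords n zero    = [] ∷ []
allWords n (suc m) = concatMap (λ w → map (_∷ w) (allFin n)) (allWords n m)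

allB : {A : Set} → (A → Bool) → List A → Bool
allB p []       = true
allB p (x ∷ xs) = p x ∧ allB p xs

filterB : {A : Set} → (A → Bool) → List A → List A
filterB p []       = []
filterB p (x ∷ xs) = if p x then x ∷ filterB p xs else filterB p xs

compatible : ∀ {n} → List (Fin n × ℕ) → Bool
compatible [] = true
compatible ((x , a) ∷ rest) =
  allB (λ { (y , b) → eqB ⌊ x Fin.≟ y ⌋ (a ≡ᵇ b) }) rest ∧ compatible rest
  where
  eqB : Bool → Bool → Bool
  eqB true  true  = true
  eqB false false = true
  eqB _     _     = false

monomialNC : ∀ n → List ℕ → Poly n
monomialNC n A =
  map (λ w → (1ℚ , w))
      (filterB (λ w → compatible (zip w A)) (allWords n (length A)))

-- elements of NCSym_n: finite linear combinations of the m_A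
NCElt : Set
NCElt = List (ℚ × SetPartition)

toPoly : ∀ n → NCElt → Poly n
toPoly n [] = []
toPoly n ((q , (A , _)) ∷ s) = scale q (monomialNC n A) ⊕ toPoly n s

-- membership in the left ideal ⟨NCSym_n^+⟩: p = Σ_j f_j g_j (as
-- polynomials) with f_j ∈ ℚ⟨X_n⟩ and g_j ∈ NCSym_n without constant term
InIdeal : ∀ n → Poly n → Set
InIdeal n p =
  Σ[ gens ∈ List (Poly n × NCElt) ]
    All (λ { (f , s) → coeff (toPoly n s) [] ≡ 0ℚ }) gens ×
    (∀ w → coeff p w ≡
      coeff (foldr (λ { (f , s) acc → (f ⊗ toPoly n s) ⊕ acc }) [] gens) w)

Homog : ∀ {n} → ℕ → Poly n → Set
Homog k p = ∀ w → length w ≢ k → coeff p w ≡ 0ℚ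

linComb : ∀ {n d} → (Fin d → ℚ) → (Fin d → Poly n) → Poly n
linComb {d = d} c v = foldr (λ i acc → scale (c i) (v i) ⊕ acc) [] (allFin d)

IndepMod : ∀ n k d → (Fin d → Poly n) → Set
IndepMod n k d v =
  (∀ i → Homog k (v i)) ×
  (∀ (c : Fin d → ℚ) → InIdeal n (linComb c v) → ∀ i → c i ≡ 0ℚ)

HasDim : ∀ n k d → Set
HasDim n k d =
  (Σ[ v ∈ (Fin d → Poly n) ] IndepMod n k d v) ×
  (∀ (v : Fin (suc d) → Poly n) → ¬ IndepMod n k (suc d) v)

sum1to : ℕ → (ℕ → ℕ) → ℕ
sum1to zero    f = 0
sum1to (suc k) f = sum1to k f ℕ.+ f (suc k)

{-# OPTIONS --safe #-}

-- Call a word standard when none of its nonempty suffixes, read with letter i as block i, is a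
-- set partition in restricted growth form.  Any other word splits as x = u v with v the shortest
-- such suffix; v is then nonsplitable, and u · m_v is an element of the left ideal whose
-- lexicographically least word is x.  Conversely every u · m_A with A nonempty is a combination
-- of these elements: m_B · m_C expands into the m_ρ over the ρ restricting to B and C, among which
-- B C has the least word, so induction on length and on the lexicographic rank applies.  Thus
-- the degree-k part of the ideal has a triangular basis indexed by the nonstandard words, the
-- standard words form a basis of the quotient, and sorting the words of length k by the length i
-- of that suffix gives n^k = #standard + Σ w_i n^(k-i).

module Submission where

open import Algebra.Structures using (IsCommutativeSemiring; IsCommutativeRing)
open import Data.Nat using (ℕ)
import Data.Nat.Properties as ℕP
import Data.Rational.Properties as ℚP
open import Relation.Binary.PropositionalEquality using (_≡_)

module ListLemmas where

  open import Data.Nat using (zero; suc)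
  open import Data.Fin as Fin using (Fin)
  open import Data.Bool using (Bool; true; false)
  open import Data.List using (List; []; _∷_; _++_; map; length; take; drop; lookup)
  open import Data.List.Membership.Propositional.Properties using (∈-lookup)
  open import Data.List.Relation.Unary.All as All using (All; []; _∷_)
  open import Data.List.Relation.Unary.AllPairs using ([]; _∷_)
  open import Data.List.Relation.Unary.Unique.Propositional using (Unique)
  open import Data.Empty using (⊥-elim)
  open import Relation.Binary.PropositionalEquality
  open import Defs using (filterB)

  take-++-length : ∀ {A : Set} (xs ys : List A) {p} → length xs ≡ p → take p (xs ++ ys) ≡ xs
  take-++-length []       ys refl = refl
  take-++-length (x ∷ xs) ys refl = cong (x ∷_) (take-++-length xs ys refl)

  drop-++-length : ∀ {A : Set} (xs ys : List A) {p} → length xs ≡ p → drop p (xs ++ ys) ≡ ys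
  drop-++-length []       ys refl = refl
  drop-++-length (x ∷ xs) ys refl = drop-++-length xs ys refl

  filterB-All : ∀ {X : Set} {P : X → Set} (q : X → Bool) {xs} → All P xs → All P (filterB q xs)
  filterB-All q {[]}     []       = []
  filterB-All q {x ∷ xs} (p ∷ ps) with q x
  ... | true  = p ∷ filterB-All q ps
  ... | false = filterB-All q ps

  filterB-true : ∀ {X : Set} (q : X → Bool) xs → All (λ x → q x ≡ true) (filterB q xs)
  filterB-true q []       = []
  filterB-true q (x ∷ xs) with q x in qx
  ... | true  = qx ∷ filterB-true q xs
  ... | false = filterB-true q xs

  filterB-unique : ∀ {X : Set} (q : X → Bool) {xs} → Unique xs → Unique (filterB q xs)
  filterB-unique q {[]}     []          = []
  filterB-unique q {x ∷ xs} (x∉ ∷ uniq) with q x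
  ... | true  = filterB-All q x∉ ∷ filterB-unique q uniq
  ... | false = filterB-unique q uniq

  lookup-injective : ∀ {X : Set} {xs : List X} → Unique xs → ∀ i j → lookup xs i ≡ lookup xs j → i ≡ j
  lookup-injective               (_ ∷ _)    Fin.zero    Fin.zero    _  = refl
  lookup-injective {xs = _ ∷ xs} (x∉ ∷ _)   Fin.zero    (Fin.suc j) eq = ⊥-elim (All.lookup x∉ (∈-lookup {xs = xs} j) eq)
  lookup-injective {xs = _ ∷ xs} (x∉ ∷ _)   (Fin.suc i) Fin.zero    eq = ⊥-elim (All.lookup x∉ (∈-lookup {xs = xs} i) (sym eq))
  lookup-injective               (_ ∷ uniq) (Fin.suc i) (Fin.suc j) eq = cong Fin.suc (lookup-injective uniq i j eq)

  All-map-filterB : ∀ {X Y : Set} {P : Y → Set} (q : X → Bool) (g : X → Y) xs →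
                    (∀ x → q x ≡ true → P (g x)) → All P (map g (filterB q xs))
  All-map-filterB q g []       _ = []
  All-map-filterB q g (x ∷ xs) P-g with q x in qx
  ... | true  = P-g x qx ∷ All-map-filterB q g xs P-g
  ... | false = All-map-filterB q g xs P-g

module Sums {R : Set} {0# 1# : R} {_+_ _*_ : R → R → R}
            (isCommutativeSemiring : IsCommutativeSemiring _≡_ _+_ _*_ 0# 1#) where

  open import Algebra.Bundles using (CommutativeSemigroup)
  open import Level using (0ℓ)
  open import Data.Nat using (ℕ; zero; suc) renaming (_+_ to _+ℕ_)
  open import Data.Fin as Fin using (Fin)
  open import Data.Bool using (Bool; true; false; if_then_else_; _∧_)
  open import Data.List using (List; []; _∷_; _++_; map; concatMap; tabulate; allFin; length; lookup)
  open import Data.List.Properties using (≡-dec; ∷-injectiveˡ; ∷-injectiveʳ)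
  open import Data.List.Membership.Propositional using (_∈_)
  open import Data.List.Membership.Propositional.Properties
    using (∈-map⁺; ∈-map⁻; ∈-concatMap⁺; ∈-concatMap⁻; ∈-allFin)
  open import Data.List.Relation.Binary.Disjoint.Propositional using (Disjoint)
  open import Data.List.Relation.Unary.All as All using (All; []; _∷_)
  import Data.List.Relation.Unary.All.Properties as AllP
  open import Data.List.Relation.Unary.Any as Any using (here; there)
  open import Data.List.Relation.Unary.AllPairs using ([]; _∷_)
  open import Data.List.Relation.Unary.Unique.Propositional using (Unique)
  open import Data.List.Relation.Unary.Unique.Propositional.Properties using (++⁺; map⁺; allFin⁺)
  open import Data.Product using (_,_)
  open import Data.Empty using (⊥-elim)
  open import Function using (_∘_)
  open import Relation.Binary.Definitions using (DecidableEquality)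
  open import Relation.Nullary using (yes; no; ⌊_⌋)
  open import Relation.Binary.PropositionalEquality
  open import Defs using (Word; allWords; filterB)

  open IsCommutativeSemiring isCommutativeSemiring
    using (+-assoc; +-identityˡ; +-identityʳ; distribˡ; zeroʳ; *-comm; +-isCommutativeSemigroup)

  +-commutativeSemigroup : CommutativeSemigroup 0ℓ 0ℓ
  +-commutativeSemigroup = record { isCommutativeSemigroup = +-isCommutativeSemigroup }

  open import Algebra.Properties.CommutativeSemigroup +-commutativeSemigroup using (interchange)

  Σl : {X : Set} → (X → R) → List X → R
  Σl f []       = 0#
  Σl f (x ∷ xs) = f x + Σl f xs

  ΣF : (m : ℕ) → (Fin m → R) → R
  ΣF zero    f = 0#
  ΣF (suc m) f = f Fin.zero + ΣF m (f ∘ Fin.suc)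

  infixr 25 [_]·_
  [_]·_ : Bool → R → R
  [ b ]· r = if b then r else 0#

  private
    variable
      X Y : Set

  Σl-++ : (f : X → R) (xs ys : List X) → Σl f (xs ++ ys) ≡ Σl f xs + Σl f ys
  Σl-++ f []       ys = sym (+-identityˡ _)
  Σl-++ f (x ∷ xs) ys = trans (cong (f x +_) (Σl-++ f xs ys)) (sym (+-assoc _ _ _))

  Σl-cong : {f g : X → R} → (∀ x → f x ≡ g x) → ∀ xs → Σl f xs ≡ Σl g xs
  Σl-cong f≗g []       = refl
  Σl-cong f≗g (x ∷ xs) = cong₂ _+_ (f≗g x) (Σl-cong f≗g xs)

  Σl-congAll : {f g : X → R} → ∀ {xs} → All (λ x → f x ≡ g x) xs → Σl f xs ≡ Σl g xs
  Σl-congAll []         = refl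
  Σl-congAll (eq ∷ eqs) = cong₂ _+_ eq (Σl-congAll eqs)

  Σl-zero : ∀ xs → Σl (λ (_ : X) → 0#) xs ≡ 0#
  Σl-zero []       = refl
  Σl-zero (x ∷ xs) = trans (+-identityˡ _) (Σl-zero xs)

  Σl-+ : (f g : X → R) → ∀ xs → Σl (λ x → f x + g x) xs ≡ Σl f xs + Σl g xs
  Σl-+ f g []       = sym (+-identityˡ 0#)
  Σl-+ f g (x ∷ xs) = trans (cong ((f x + g x) +_) (Σl-+ f g xs)) (interchange _ _ _ _)

  Σl-*ˡ : (c : R) (f : X → R) → ∀ xs → Σl (λ x → c * f x) xs ≡ c * Σl f xs
  Σl-*ˡ c f []       = sym (zeroʳ c)
  Σl-*ˡ c f (x ∷ xs) = trans (cong ((c * f x) +_) (Σl-*ˡ c f xs)) (sym (distribˡ _ _ _))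

  Σl-map : (f : Y → R) (g : X → Y) → ∀ xs → Σl f (map g xs) ≡ Σl (f ∘ g) xs
  Σl-map f g []       = refl
  Σl-map f g (x ∷ xs) = cong (f (g x) +_) (Σl-map f g xs)

  Σl-concatMap : (f : Y → R) (g : X → List Y) → ∀ xs →
                 Σl f (concatMap g xs) ≡ Σl (λ x → Σl f (g x)) xs
  Σl-concatMap f g []       = refl
  Σl-concatMap f g (x ∷ xs) =
    trans (Σl-++ f (g x) (concatMap g xs)) (cong (Σl f (g x) +_) (Σl-concatMap f g xs))

  Σl-swap : (f : X → Y → R) → ∀ xs ys →
            Σl (λ x → Σl (f x) ys) xs ≡ Σl (λ y → Σl (λ x → f x y) xs) ys
  Σl-swap f []       ys = sym (Σl-zero ys)
  Σl-swap f (x ∷ xs) ys =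
    trans (cong (Σl (f x) ys +_) (Σl-swap f xs ys)) (sym (Σl-+ (f x) _ ys))

  Σl-filterB : (p : X → Bool) (f : X → R) → ∀ xs →
               Σl f (filterB p xs) ≡ Σl (λ x → [ p x ]· f x) xs
  Σl-filterB p f []       = refl
  Σl-filterB p f (x ∷ xs) with p x
  ... | true  = cong (f x +_) (Σl-filterB p f xs)
  ... | false = trans (Σl-filterB p f xs) (sym (+-identityˡ _))

  Σl-tabulate : ∀ m (f : X → R) (g : Fin m → X) → Σl f (tabulate g) ≡ ΣF m (f ∘ g)
  Σl-tabulate zero    f g = refl
  Σl-tabulate (suc m) f g = cong (f (g Fin.zero) +_) (Σl-tabulate m f (g ∘ Fin.suc))

  Σl-lookup : ∀ {X : Set} (f : X → R) xs → Σl f xs ≡ ΣF (length xs) (f ∘ lookup xs)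
  Σl-lookup f []       = refl
  Σl-lookup f (x ∷ xs) = cong (f x +_) (Σl-lookup f xs)

  ΣF-cong : ∀ m {f g : Fin m → R} → (∀ i → f i ≡ g i) → ΣF m f ≡ ΣF m g
  ΣF-cong zero    f≗g = refl
  ΣF-cong (suc m) f≗g = cong₂ _+_ (f≗g Fin.zero) (ΣF-cong m (f≗g ∘ Fin.suc))

  ΣF-zero : ∀ m → ΣF m (λ _ → 0#) ≡ 0#
  ΣF-zero zero    = refl
  ΣF-zero (suc m) = trans (+-identityˡ _) (ΣF-zero m)

  ΣF-+ : ∀ m (f g : Fin m → R) → ΣF m (λ i → f i + g i) ≡ ΣF m f + ΣF m g
  ΣF-+ zero    f g = sym (+-identityˡ 0#)
  ΣF-+ (suc m) f g =
    trans (cong (_ +_) (ΣF-+ m (f ∘ Fin.suc) (g ∘ Fin.suc))) (interchange _ _ _ _)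

  ΣF-*ˡ : ∀ m (c : R) (f : Fin m → R) → ΣF m (λ i → c * f i) ≡ c * ΣF m f
  ΣF-*ˡ zero    c f = sym (zeroʳ c)
  ΣF-*ˡ (suc m) c f = trans (cong (_ +_) (ΣF-*ˡ m c (f ∘ Fin.suc))) (sym (distribˡ _ _ _))

  ΣF-*ʳ : ∀ m (f : Fin m → R) (c : R) → ΣF m (λ i → f i * c) ≡ ΣF m f * c
  ΣF-*ʳ m f c = trans (ΣF-cong m (λ i → *-comm (f i) c)) (trans (ΣF-*ˡ m c f) (*-comm c (ΣF m f)))

  []·-0 : ∀ b → [ b ]· 0# ≡ 0#
  []·-0 true  = refl
  []·-0 false = refl

  []·-+ : ∀ b x y → [ b ]· (x + y) ≡ [ b ]· x + [ b ]· y
  []·-+ true  x y = refl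
  []·-+ false x y = sym (+-identityˡ 0#)

  []·-*ʳ : ∀ b c d → [ b ]· (c * d) ≡ c * [ b ]· d
  []·-*ʳ true  c d = refl
  []·-*ʳ false c d = sym (zeroʳ c)

  []·-∧ : ∀ b₁ b₂ x → [ b₁ ∧ b₂ ]· x ≡ [ b₁ ]· [ b₂ ]· x
  []·-∧ true  b₂ x = refl
  []·-∧ false b₂ x = refl

  []·-comm : ∀ b₁ b₂ x → [ b₁ ]· [ b₂ ]· x ≡ [ b₂ ]· [ b₁ ]· x
  []·-comm true  b₂    x = refl
  []·-comm false true  x = refl
  []·-comm false false x = refl

  []·-Σl : ∀ b (f : X → R) xs → [ b ]· Σl f xs ≡ Σl (λ x → [ b ]· f x) xs
  []·-Σl true  f xs = refl
  []·-Σl false f xs = sym (Σl-zero xs)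

  module _ (_≟_ : DecidableEquality X) where

    Σl-indicator-∉ : (f : X → R) (r : X) → ∀ {xs} → All (r ≢_) xs →
                     Σl (λ x → [ ⌊ x ≟ r ⌋ ]· f x) xs ≡ 0#
    Σl-indicator-∉ f r []                = refl
    Σl-indicator-∉ f r {x ∷ _} (r≢x ∷ ps) with x ≟ r
    ... | yes x≡r = ⊥-elim (r≢x (sym x≡r))
    ... | no  _   = trans (+-identityˡ _) (Σl-indicator-∉ f r ps)

    Σl-indicator : (f : X → R) (r : X) → ∀ {xs} → Unique xs → r ∈ xs →
                   Σl (λ x → [ ⌊ x ≟ r ⌋ ]· f x) xs ≡ f r
    Σl-indicator f r {x ∷ xs} (x∉xs ∷ _) (here refl) with x ≟ x
    ... | yes _   = trans (cong (f x +_) (Σl-indicator-∉ f x x∉xs)) (+-identityʳ _)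
    ... | no x≢x  = ⊥-elim (x≢x refl)
    Σl-indicator f r {x ∷ xs} (x∉xs ∷ u) (there r∈xs) with x ≟ r
    ... | yes refl = ⊥-elim (All.lookup x∉xs r∈xs refl)
    ... | no  _    = trans (+-identityˡ _) (Σl-indicator f r u r∈xs)

  module WordSums (n : ℕ) where

    infix 4 _≟ʷ_
    _≟ʷ_ : DecidableEquality (Word n)
    _≟ʷ_ = ≡-dec Fin._≟_

    ΣW : ℕ → (Word n → R) → R
    ΣW m f = Σl f (allWords n m)

    allWords-length : ∀ m → All (λ x → length x ≡ m) (allWords n m)
    allWords-length zero    = refl ∷ []
    allWords-length (suc m) = go (allWords-length m)
      where
      go : ∀ {ws} → All (λ x → length x ≡ m) ws →
           All (λ x → length x ≡ suc m) (concatMap (λ w → map (_∷ w) (allFin n)) ws)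
      go []         = []
      go (eq ∷ eqs) = AllP.++⁺ (AllP.map⁺ (AllP.tabulate⁺ (λ _ → cong suc eq))) (go eqs)

    ∈-allWords : ∀ x → x ∈ allWords n (length x)
    ∈-allWords []      = here refl
    ∈-allWords (a ∷ x) =
      ∈-concatMap⁺ _ (Any.map (λ { refl → ∈-map⁺ (_∷ x) (∈-allFin a) }) (∈-allWords x))

    allWords-unique : ∀ m → Unique (allWords n m)
    allWords-unique zero    = [] ∷ []
    allWords-unique (suc m) = go (allWords-unique m)
      where
      go : ∀ {ws} → Unique ws → Unique (concatMap (λ w → map (_∷ w) (allFin n)) ws)
      go []                  = []
      go {w ∷ ws} (w∉ws ∷ u) = ++⁺ (map⁺ ∷-injectiveˡ (allFin⁺ n)) (go u) disjoint
        where
        disjoint : Disjoint (map (_∷ w) (allFin n)) (concatMap (λ w → map (_∷ w) (allFin n)) ws)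
        disjoint (v∈₁ , v∈₂) with ∈-map⁻ _ v∈₁
        ... | _ , _ , refl = All.lookupWith
                (λ w≢w′ v∈ → let _ , _ , eq = ∈-map⁻ _ v∈ in w≢w′ (∷-injectiveʳ eq))
                w∉ws (∈-concatMap⁻ _ v∈₂)

    ΣW-cong : ∀ m {f g : Word n → R} → (∀ x → length x ≡ m → f x ≡ g x) → ΣW m f ≡ ΣW m g
    ΣW-cong m f≗g = Σl-congAll (All.map (λ {x} → f≗g x) (allWords-length m))

    ΣW-indicator : ∀ {m} (f : Word n → R) r → length r ≡ m → ΣW m (λ x → [ ⌊ x ≟ʷ r ⌋ ]· f x) ≡ f r
    ΣW-indicator {m} f r refl = Σl-indicator _≟ʷ_ f r (allWords-unique m) (∈-allWords r)

    ΣW-suc : ∀ m f → ΣW (suc m) f ≡ ΣW m (λ w → ΣF n (λ a → f (a ∷ w)))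
    ΣW-suc m f = trans (Σl-concatMap f _ (allWords n m))
      (Σl-cong (λ w → trans (Σl-map f (_∷ w) (allFin n)) (Σl-tabulate n (λ a → f (a ∷ w)) (λ a → a)))
               (allWords n m))

    ΣW-split : ∀ p q f → ΣW (p +ℕ q) f ≡ ΣW p (λ u → ΣW q (λ v → f (u ++ v)))
    ΣW-split zero    q f = sym (+-identityʳ _)
    ΣW-split (suc p) q f = begin
      ΣW (suc p +ℕ q) f
        ≡⟨ ΣW-suc (p +ℕ q) f ⟩
      ΣW (p +ℕ q) (λ w → ΣF n (λ a → f (a ∷ w)))
        ≡⟨ ΣW-split p q _ ⟩
      ΣW p (λ u → ΣW q (λ v → ΣF n (λ a → f (a ∷ u ++ v))))
        ≡⟨ Σl-cong (λ u → ΣW-ΣF (λ a v → f (a ∷ u ++ v))) (allWords n p) ⟩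
      ΣW p (λ u → ΣF n (λ a → ΣW q (λ v → f (a ∷ u ++ v))))
        ≡⟨ ΣW-suc p (λ u → ΣW q (λ v → f (u ++ v))) ⟨
      ΣW (suc p) (λ u → ΣW q (λ v → f (u ++ v)))  ∎
      where
      open ≡-Reasoning
      ΣW-ΣF : (h : Fin n → Word n → R) → ΣW q (λ v → ΣF n (λ a → h a v)) ≡ ΣF n (λ a → ΣW q (h a))
      ΣW-ΣF h = begin
        ΣW q (λ v → ΣF n (λ a → h a v))           ≡⟨ Σl-cong (λ v → Σl-tabulate n (λ a → h a v) (λ a → a)) (allWords n q) ⟨
        ΣW q (λ v → Σl (λ a → h a v) (allFin n))  ≡⟨ Σl-swap (λ v a → h a v) (allWords n q) (allFin n) ⟩
        Σl (λ a → ΣW q (h a)) (allFin n)          ≡⟨ Σl-tabulate n (λ a → ΣW q (h a)) (λ a → a) ⟩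
        ΣF n (λ a → ΣW q (h a))                   ∎

module Patterns where

  open import Data.Nat using (ℕ; zero; suc; _≤_; _<_; _⊔_; _⊓_; _+_; _∸_; z≤n; s≤s; _≤?_; _<?_)
  open import Data.Nat.Properties
  open import Relation.Binary.Definitions using (tri<; tri≈; tri>)
  open import Data.Bool using (Bool; true; false)
  open import Data.List using (List; []; _∷_; _++_; _∷ʳ_; length; take; drop)
  open import Data.List.Properties using (length-++; ∷ʳ-++; length-take; length-drop; ∷-injective)
  open import Data.Maybe using (Maybe; just; nothing)
  open import Data.Maybe.Properties using (just-injective)
  open import Data.Product using (Σ-syntax; ∃-syntax; _×_; _,_; proj₁; proj₂)
  open import Data.Sum using (_⊎_; inj₁; inj₂)
  open import Data.Unit using (tt)
  open import Data.Empty using (⊥; ⊥-elim)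
  open import Function using (_∘_)
  open import Relation.Nullary using (¬_; Dec; yes; no; does)
  open import Relation.Nullary.Decidable using (dec-true)
  open import Relation.Binary.PropositionalEquality
  open import Defs using (IsRGSFrom; IsSetPartition; Nonsplitable)

  nth : List ℕ → ℕ → Maybe ℕ
  nth []       _       = nothing
  nth (x ∷ xs) zero    = just x
  nth (x ∷ xs) (suc i) = nth xs i

  nth-++-length : ∀ xs y ys → nth (xs ++ y ∷ ys) (length xs) ≡ just y
  nth-++-length []       y ys = refl
  nth-++-length (x ∷ xs) y ys = nth-++-length xs y ys

  nth-++ˡ : ∀ xs ys {i l} → nth xs i ≡ just l → nth (xs ++ ys) i ≡ just l
  nth-++ˡ (x ∷ xs) ys {zero}  eq = eq
  nth-++ˡ (x ∷ xs) ys {suc i} eq = nth-++ˡ xs ys eq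

  nth-drop : ∀ p xs i → nth (drop p xs) i ≡ nth xs (p + i)
  nth-drop zero    xs       i = refl
  nth-drop (suc p) []       i = refl
  nth-drop (suc p) (x ∷ xs) i = nth-drop p xs i

  nth-take-< : ∀ {p i} xs → i < p → nth (take p xs) i ≡ nth xs i
  nth-take-< {suc p} {zero}  []       _         = refl
  nth-take-< {suc p} {zero}  (x ∷ xs) _         = refl
  nth-take-< {suc p} {suc i} []       _         = refl
  nth-take-< {suc p} {suc i} (x ∷ xs) (s≤s i<p) = nth-take-< xs i<p

  nth-take-≥ : ∀ {p i} xs → p ≤ i → nth (take p xs) i ≡ nothing
  nth-take-≥ {zero}          xs       _         = refl
  nth-take-≥ {suc p} {suc i} []       _         = refl
  nth-take-≥ {suc p} {suc i} (x ∷ xs) (s≤s p≤i) = nth-take-≥ xs p≤i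

  nth≡nothing⇒length≤ : ∀ xs {i} → nth xs i ≡ nothing → length xs ≤ i
  nth≡nothing⇒length≤ []                 _  = z≤n
  nth≡nothing⇒length≤ (x ∷ xs) {suc i} eq = s≤s (nth≡nothing⇒length≤ xs eq)

  length≤⇒nth≡nothing : ∀ xs {i} → length xs ≤ i → nth xs i ≡ nothing
  length≤⇒nth≡nothing []       _         = refl
  length≤⇒nth≡nothing (x ∷ xs) (s≤s le) = length≤⇒nth≡nothing xs le

  Finer : List ℕ → List ℕ → Set
  Finer xs ys = ∀ i j → nth xs i ≡ nth xs j → nth ys i ≡ nth ys j

  record SamePattern (xs ys : List ℕ) : Set where
    constructor samePattern
    field
      length≡ : length xs ≡ length ys
      finer   : Finer xs ys
      coarser : Finer ys xs

  SamePattern-refl : ∀ xs → SamePattern xs xs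
  SamePattern-refl xs = samePattern refl (λ _ _ eq → eq) (λ _ _ eq → eq)

  SamePattern-sym : ∀ {xs ys} → SamePattern xs ys → SamePattern ys xs
  SamePattern-sym (samePattern len f g) = samePattern (sym len) g f

  SamePattern-trans : ∀ {xs ys zs} → SamePattern xs ys → SamePattern ys zs → SamePattern xs zs
  SamePattern-trans (samePattern len₁ f₁ g₁) (samePattern len₂ f₂ g₂) =
    samePattern (trans len₁ len₂) (λ i j → f₂ i j ∘ f₁ i j) (λ i j → g₁ i j ∘ g₂ i j)

  nth≡nothing-transfer : ∀ xs ys {i} → length xs ≡ length ys → nth xs i ≡ nothing → nth ys i ≡ nothing
  nth≡nothing-transfer xs ys {i} len =
    length≤⇒nth≡nothing ys ∘ subst (_≤ i) len ∘ nth≡nothing⇒length≤ xs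

  Finer-take : ∀ p {xs ys} → length xs ≡ length ys → Finer xs ys → Finer (take p xs) (take p ys)
  Finer-take p {xs} {ys} len f i j eq with i <? p | j <? p
  ... | yes i<p | yes j<p = begin
    nth (take p ys) i  ≡⟨ nth-take-< ys i<p ⟩
    nth ys i           ≡⟨ f i j (trans (sym (nth-take-< xs i<p)) (trans eq (nth-take-< xs j<p))) ⟩
    nth ys j           ≡⟨ nth-take-< ys j<p ⟨
    nth (take p ys) j  ∎
    where open ≡-Reasoning
  ... | yes i<p | no j≮p = trans (nth-take-< ys i<p)
    (trans (nth≡nothing-transfer xs ys len (trans (sym (nth-take-< xs i<p)) (trans eq (nth-take-≥ xs (≮⇒≥ j≮p)))))
           (sym (nth-take-≥ ys (≮⇒≥ j≮p))))
  ... | no i≮p | yes j<p = trans (nth-take-≥ ys (≮⇒≥ i≮p))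
    (trans (sym (nth≡nothing-transfer xs ys len (trans (sym (nth-take-< xs j<p)) (trans (sym eq) (nth-take-≥ xs (≮⇒≥ i≮p))))))
           (sym (nth-take-< ys j<p)))
  ... | no i≮p | no j≮p = trans (nth-take-≥ ys (≮⇒≥ i≮p)) (sym (nth-take-≥ ys (≮⇒≥ j≮p)))

  Finer-drop : ∀ p {xs ys} → Finer xs ys → Finer (drop p xs) (drop p ys)
  Finer-drop p {xs} {ys} f i j eq =
    trans (nth-drop p ys i) (trans (f (p + i) (p + j) (trans (sym (nth-drop p xs i)) (trans eq (nth-drop p xs j))))
                                   (sym (nth-drop p ys j)))

  SamePattern-take : ∀ p {xs ys} → SamePattern xs ys → SamePattern (take p xs) (take p ys)
  SamePattern-take p {xs} {ys} (samePattern len f g) = samePattern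
    (trans (length-take p xs) (trans (cong (p ⊓_) len) (sym (length-take p ys))))
    (Finer-take p len f) (Finer-take p (sym len) g)

  SamePattern-drop : ∀ p {xs ys} → SamePattern xs ys → SamePattern (drop p xs) (drop p ys)
  SamePattern-drop p {xs} {ys} (samePattern len f g) = samePattern
    (trans (length-drop p xs) (trans (cong (_∸ p) len) (sym (length-drop p ys))))
    (Finer-drop p f) (Finer-drop p g)

  Finer-∷ : ∀ {x y xs ys} → (∀ j → nth xs j ≡ just x → nth ys j ≡ just y) → Finer xs ys →
            Finer (x ∷ xs) (y ∷ ys)
  Finer-∷ h f zero    zero    _  = refl
  Finer-∷ h f zero    (suc j) eq = sym (h j (sym eq))
  Finer-∷ h f (suc i) zero    eq = h i eq
  Finer-∷ h f (suc i) (suc j) eq = f i j eq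

  Finer-∷⁻ : ∀ {x y xs ys} → Finer (x ∷ xs) (y ∷ ys) →
             (∀ j → nth xs j ≡ just x → nth ys j ≡ just y) × Finer xs ys
  Finer-∷⁻ f = (λ j → f (suc j) zero) , (λ i j → f (suc i) (suc j))

  HeadAgrees : ℕ → ℕ → List ℕ → List ℕ → Set
  HeadAgrees x y xs ys = ∀ j → (nth xs j ≡ just x → nth ys j ≡ just y) × (nth ys j ≡ just y → nth xs j ≡ just x)

  SamePattern-∷ : ∀ {x y xs ys} → HeadAgrees x y xs ys → SamePattern xs ys → SamePattern (x ∷ xs) (y ∷ ys)
  SamePattern-∷ h (samePattern len f g) =
    samePattern (cong suc len) (Finer-∷ (proj₁ ∘ h) f) (Finer-∷ (proj₂ ∘ h) g)

  SamePattern-∷⁻ : ∀ {x y xs ys} → SamePattern (x ∷ xs) (y ∷ ys) → HeadAgrees x y xs ys × SamePattern xs ys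
  SamePattern-∷⁻ (samePattern len f g) =
    (λ j → proj₁ (Finer-∷⁻ f) j , proj₁ (Finer-∷⁻ g) j) ,
    samePattern (suc-injective len) (proj₂ (Finer-∷⁻ f)) (proj₂ (Finer-∷⁻ g))

  infix 4 _<ₗₑₓ_
  _<ₗₑₓ_ : List ℕ → List ℕ → Set
  (x ∷ xs) <ₗₑₓ (y ∷ ys) = x < y ⊎ (x ≡ y × xs <ₗₑₓ ys)
  _        <ₗₑₓ _        = ⊥

  <ₗₑₓ-asym : ∀ xs ys → xs <ₗₑₓ ys → ¬ ys <ₗₑₓ xs
  <ₗₑₓ-asym (x ∷ xs) (y ∷ ys) (inj₁ x<y)        (inj₁ y<x)        = <-asym x<y y<x
  <ₗₑₓ-asym (x ∷ xs) (y ∷ ys) (inj₁ x<y)        (inj₂ (refl , _)) = <-irrefl refl x<y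
  <ₗₑₓ-asym (x ∷ xs) (y ∷ ys) (inj₂ (refl , _)) (inj₁ y<x)        = <-irrefl refl y<x
  <ₗₑₓ-asym (x ∷ xs) (y ∷ ys) (inj₂ (refl , l)) (inj₂ (_ , l′))   = <ₗₑₓ-asym xs ys l l′

  <ₗₑₓ-++ : ∀ us {xs ys} → xs <ₗₑₓ ys → us ++ xs <ₗₑₓ us ++ ys
  <ₗₑₓ-++ []       lt = lt
  <ₗₑₓ-++ (u ∷ us) lt = inj₂ (refl , <ₗₑₓ-++ us lt)

  <ₗₑₓ-trichotomy : ∀ xs ys → length xs ≡ length ys → xs ≡ ys ⊎ xs <ₗₑₓ ys ⊎ ys <ₗₑₓ xs
  <ₗₑₓ-trichotomy []       []       _   = inj₁ refl
  <ₗₑₓ-trichotomy (x ∷ xs) (y ∷ ys) len with <-cmp x y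
  ... | tri< x<y _ _ = inj₂ (inj₁ (inj₁ x<y))
  ... | tri> _ _ y<x = inj₂ (inj₂ (inj₁ y<x))
  ... | tri≈ _ refl _ with <ₗₑₓ-trichotomy xs ys (suc-injective len)
  ...   | inj₁ refl        = inj₁ refl
  ...   | inj₂ (inj₁ lt)   = inj₂ (inj₁ (inj₂ (refl , lt)))
  ...   | inj₂ (inj₂ gt)   = inj₂ (inj₂ (inj₂ (refl , gt)))

  Covers : ℕ → List ℕ → Set
  Covers k pre = ∀ l → l < k → ∃[ q ] nth pre q ≡ just l

  Covers-∷ʳ : ∀ {k} pre {a} → a ≤ k → Covers k pre → Covers (k ⊔ suc a) (pre ∷ʳ a)
  Covers-∷ʳ {k} pre {a} a≤k cov l l< with l <? k
  ... | yes l<k = let q , eq = cov l l<k in q , nth-++ˡ pre _ eq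
  ... | no l≮k  = length pre , trans (nth-++-length pre a []) (cong just a≡l)
    where
    l≤a : l ≤ a
    l≤a with ≤-total k (suc a)
    ... | inj₁ k≤1+a = ≤-pred (subst (l <_) (m≤n⇒m⊔n≡n k≤1+a) l<)
    ... | inj₂ 1+a≤k = ⊥-elim (l≮k (subst (l <_) (m≥n⇒m⊔n≡m 1+a≤k) l<))
    a≡l : a ≡ l
    a≡l = ≤-antisym (≤-trans a≤k (≮⇒≥ l≮k)) l≤a

  Covers-transfer : ∀ {k} pre {y ys y′ ys′} → Covers k pre → y < k →
                    Finer (pre ++ y ∷ ys) (pre ++ y′ ∷ ys′) → y′ ≡ y
  Covers-transfer pre {y} {ys} {y′} {ys′} cov y<k f =
    let q , eq = cov y y<k in
    sym (just-injective (trans (sym (nth-++ˡ pre (y′ ∷ ys′) eq))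
      (trans (f q (length pre) (trans (nth-++ˡ pre (y ∷ ys) eq) (sym (nth-++-length pre y ys))))
             (nth-++-length pre y′ ys′))))

  private
    length-++-≢ : ∀ (pre : List ℕ) a as → length (pre ++ []) ≢ length (pre ++ a ∷ as)
    length-++-≢ []        a as ()
    length-++-≢ (x ∷ pre) a as eq = length-++-≢ pre a as (suc-injective eq)

  rgs-head-< : ∀ {k} pre {x zs a as} → Covers k pre → a ≤ k →
               SamePattern (pre ++ x ∷ zs) (pre ++ a ∷ as) → x ≢ a → a < x
  rgs-head-< {k} pre {x} {a = a} cov a≤k (samePattern _ f g) x≢a = ≤∧≢⇒< (subst (_≤ x) (sym a≡k) k≤x) (x≢a ∘ sym)
    where
    a≡k : a ≡ k
    a≡k with a <? k
    ... | yes a<k = ⊥-elim (x≢a (Covers-transfer pre cov a<k g))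
    ... | no  a≮k = ≤-antisym a≤k (≮⇒≥ a≮k)
    k≤x : k ≤ x
    k≤x with x <? k
    ... | yes x<k = ⊥-elim (x≢a (sym (Covers-transfer pre cov x<k f)))
    ... | no  x≮k = ≮⇒≥ x≮k

  -- At the first position where zs and the restricted growth string differ, the latter uses the
  -- least unused label k, while zs must also use a label not seen before, hence one ≥ k.
  rgs-lexLeast-from : ∀ pre k zs as → Covers k pre → IsRGSFrom k as →
                      SamePattern (pre ++ zs) (pre ++ as) → as ≡ zs ⊎ as <ₗₑₓ zs
  rgs-lexLeast-from pre k []       []       cov _ _          = inj₁ refl
  rgs-lexLeast-from pre k []       (a ∷ as) cov _ (samePattern len _ _)  = ⊥-elim (length-++-≢ pre a as len)
  rgs-lexLeast-from pre k (x ∷ zs) []       cov _ (samePattern len _ _)  = ⊥-elim (length-++-≢ pre x zs (sym len))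
  rgs-lexLeast-from pre k (x ∷ zs) (a ∷ as) cov (a≤k , rgs) same with x ≟ a
  ... | no x≢a  = inj₂ (inj₁ (rgs-head-< pre cov a≤k same x≢a))
  ... | yes refl with rgs-lexLeast-from (pre ∷ʳ x) (k ⊔ suc x) zs as (Covers-∷ʳ pre a≤k cov) rgs
                        (subst₂ SamePattern (sym (∷ʳ-++ pre x zs)) (sym (∷ʳ-++ pre x as)) same)
  ...   | inj₁ refl = inj₁ refl
  ...   | inj₂ lt   = inj₂ (inj₂ (refl , lt))

  rgs-lexLeast : ∀ {zs as} → IsSetPartition as → SamePattern zs as → as ≡ zs ⊎ as <ₗₑₓ zs
  rgs-lexLeast {zs} {as} = rgs-lexLeast-from [] 0 zs as (λ _ ())

  rgs-unique : ∀ {as bs} → IsSetPartition as → IsSetPartition bs → SamePattern as bs → as ≡ bs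
  rgs-unique {as} {bs} rgs-as rgs-bs same
    with rgs-lexLeast rgs-bs same | rgs-lexLeast rgs-as (SamePattern-sym same)
  ... | inj₁ eq | _       = sym eq
  ... | inj₂ _  | inj₁ eq = eq
  ... | inj₂ lt | inj₂ gt = ⊥-elim (<ₗₑₓ-asym bs as lt gt)

  isRGSFrom? : ∀ k xs → Dec (IsRGSFrom k xs)
  isRGSFrom? k []       = yes tt
  isRGSFrom? k (x ∷ xs) with x ≤? k | isRGSFrom? (k ⊔ suc x) xs
  ... | yes x≤k | yes rgs = yes (x≤k , rgs)
  ... | no  x≰k | _       = no (x≰k ∘ proj₁)
  ... | yes _   | no ¬rgs = no (¬rgs ∘ proj₂)

  isSetPartitionᵇ : List ℕ → Bool
  isSetPartitionᵇ xs = does (isRGSFrom? 0 xs)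

  isSetPartitionᵇ-sound : ∀ xs → isSetPartitionᵇ xs ≡ true → IsSetPartition xs
  isSetPartitionᵇ-sound xs eq with isRGSFrom? 0 xs
  ... | yes rgs = rgs

  isSetPartitionᵇ-complete : ∀ {xs} → IsSetPartition xs → isSetPartitionᵇ xs ≡ true
  isSetPartitionᵇ-complete {xs} = dec-true (isRGSFrom? 0 xs)

  IsRGSFrom-++⁻ˡ : ∀ k xs {ys} → IsRGSFrom k (xs ++ ys) → IsRGSFrom k xs
  IsRGSFrom-++⁻ˡ k []       _           = tt
  IsRGSFrom-++⁻ˡ k (x ∷ xs) (x≤k , rgs) = x≤k , IsRGSFrom-++⁻ˡ (k ⊔ suc x) xs rgs

  -- Length of the shortest nonempty suffix of xs in restricted growth form,
  -- or 0 if there is none.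
  rgsTail : List ℕ → ℕ
  rgsTail []       = 0
  rgsTail (x ∷ xs) with rgsTail xs | isSetPartitionᵇ (x ∷ xs)
  ... | suc m | _     = suc m
  ... | zero  | true  = suc (length xs)
  ... | zero  | false = 0

  rgsTail-≤ : ∀ xs → rgsTail xs ≤ length xs
  rgsTail-≤ []       = z≤n
  rgsTail-≤ (x ∷ xs) with rgsTail xs | rgsTail-≤ xs | isSetPartitionᵇ (x ∷ xs)
  ... | suc m | m<len | _     = m≤n⇒m≤1+n m<len
  ... | zero  | _     | true  = ≤-refl
  ... | zero  | _     | false = z≤n

  rgsTail-setPartition : ∀ {x xs} → IsSetPartition (x ∷ xs) → rgsTail (x ∷ xs) ≢ 0
  rgsTail-setPartition {x} {xs} rgs
    with rgsTail xs | isSetPartitionᵇ (x ∷ xs) | isSetPartitionᵇ-complete rgs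
  ... | suc m | _    | _ = λ ()
  ... | zero  | true | _ = λ ()

  rgsTail-nonempty : ∀ xs → 1 ≤ length xs → IsSetPartition xs → rgsTail xs ≢ 0
  rgsTail-nonempty (x ∷ xs) _ = rgsTail-setPartition

  rgsTail-++ : ∀ us {xs} → rgsTail xs ≢ 0 → rgsTail (us ++ xs) ≡ rgsTail xs
  rgsTail-++ []       ne = refl
  rgsTail-++ (u ∷ us) {xs} ne with rgsTail (us ++ xs) | rgsTail-++ us {xs} ne
  ... | zero  | eq = ⊥-elim (ne (sym eq))
  ... | suc m | eq = eq

  rgsTail-++-full : ∀ us xs → rgsTail (us ++ xs) ≡ length xs → rgsTail xs ≡ length xs
  rgsTail-++-full []       xs eq = eq
  rgsTail-++-full (u ∷ us) xs eq
    with rgsTail (us ++ xs) | rgsTail-++-full us xs | isSetPartitionᵇ (u ∷ us ++ xs)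
  ... | suc m | ih | _     = ih eq
  ... | zero  | ih | false = ih eq
  ... | zero  | ih | true  = ⊥-elim (<-irrefl (sym eq) (s≤s (subst (length xs ≤_) (sym (length-++ us)) (m≤n+m _ _))))

  rgsTail-suffix : ∀ xs → rgsTail xs ≢ 0 →
                   Σ[ us ∈ List ℕ ] Σ[ as ∈ List ℕ ]
                     xs ≡ us ++ as × length as ≡ rgsTail xs × IsSetPartition as
  rgsTail-suffix []       ne = ⊥-elim (ne refl)
  rgsTail-suffix (x ∷ xs) ne with rgsTail xs in eq | isSetPartitionᵇ (x ∷ xs) in rgs
  ... | zero  | true  = [] , x ∷ xs , refl , refl , isSetPartitionᵇ-sound (x ∷ xs) rgs
  ... | zero  | false = ⊥-elim (ne refl)
  ... | suc m | _ with rgsTail-suffix xs (λ eq′ → 0≢1+n (trans (sym eq′) eq))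
  ...   | us , as , refl , len , rgs-as = x ∷ us , as , refl , trans len eq , rgs-as

  rgsTail-full⇒nonsplitable : ∀ xs → 1 ≤ length xs → rgsTail xs ≡ length xs → Nonsplitable xs
  rgsTail-full⇒nonsplitable (x ∷ xs) _ full
    with rgsTail xs in tail≡ | isSetPartitionᵇ (x ∷ xs) in rgs | rgsTail-≤ xs
  ... | suc m | _     | m<len = ⊥-elim (<-irrefl (suc-injective full) m<len)
  ... | zero  | true  | _     = isSetPartitionᵇ-sound (x ∷ xs) rgs , s≤s z≤n , no-split
    where
    no-split : ¬ (Σ[ B ∈ List ℕ ] Σ[ C ∈ List ℕ ] IsSetPartition B × (1 ≤ length B) ×
                  IsSetPartition C × (1 ≤ length C) × (x ∷ xs ≡ B ++ C))
    no-split (b ∷ B , c ∷ C , _ , _ , rgs-C , _ , split) with ∷-injective split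
    ... | _ , refl = rgsTail-setPartition rgs-C
                       (trans (sym (rgsTail-++ B (rgsTail-setPartition rgs-C))) tail≡)

  nonsplitable⇒rgsTail-full : ∀ xs → Nonsplitable xs → rgsTail xs ≡ length xs
  nonsplitable⇒rgsTail-full (x ∷ xs) (rgs , _ , no-split)
    with rgsTail xs in tail≡ | isSetPartitionᵇ (x ∷ xs) | isSetPartitionᵇ-complete rgs
  ... | zero  | true | _ = refl
  ... | suc m | _    | _ with rgsTail-suffix xs (λ tail≡0 → 1+n≢0 (trans (sym tail≡) tail≡0))
  ...   | us , []     , refl , len , _      = ⊥-elim (0≢1+n (trans len tail≡))
  ...   | us , c ∷ as , refl , _   , rgs-as =
    ⊥-elim (no-split (x ∷ us , c ∷ as , IsRGSFrom-++⁻ˡ 0 (x ∷ us) rgs , s≤s z≤n , rgs-as , s≤s z≤n , refl))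


module Words (n : ℕ) where

  open import Data.Nat using (zero; suc; _≤_; _<_; _⊔_; _+_; _∸_; _*_; _^_; _≡ᵇ_; _<?_; z≤n; s≤s)
  open import Data.Nat.Induction using (<-wellFounded)
  import Induction.WellFounded as WF
  import Relation.Binary.Construct.On as On
  open import Level using (0ℓ)
  open import Data.Nat.Properties
  open import Data.Fin as Fin using (Fin; toℕ; fromℕ<)
  open import Data.Fin.Properties using (toℕ-injective; toℕ<n; toℕ-fromℕ<)
  open import Data.Fin.Permutation.Components using (transpose; transpose-inverse)
  open import Data.Bool using (Bool; true; false; _∧_; T)
  open import Data.Bool.Properties using (∧-identityʳ; ∧-conicalˡ; ∧-conicalʳ)
  open import Data.List using (List; []; _∷_; _++_; map; length; zip)
  open import Data.List.Properties using (length-map; map-injective; map-++; map-∘; map-id; ++-assoc; map-id-local)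
  open import Data.List.Relation.Unary.All as All using (All; []; _∷_)
  import Data.List.Relation.Unary.All.Properties as AllP
  open import Data.Maybe using (just)
  open import Data.Maybe.Properties using (just-injective)
  open import Data.Product using (_×_; _,_; proj₁; proj₂)
  open import Data.Sum using (inj₁; inj₂)
  open import Data.Empty using (⊥-elim)
  open import Function using (_∘_; id)
  open import Relation.Nullary using (¬_; yes; no)
  open import Relation.Nullary.Decidable using (dec-true; dec-false)
  open import Relation.Binary.PropositionalEquality
  open import Defs using (Word; IsRGSFrom; IsSetPartition; compatible; allB)
  open Patterns

  labels : Word n → List ℕ
  labels = map toℕ

  length-labels : ∀ w → length (labels w) ≡ length w
  length-labels = length-map toℕ

  labels-injective : ∀ {u w} → labels u ≡ labels w → u ≡ w
  labels-injective = map-injective toℕ-injective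

  labels-++ : ∀ u w → labels (u ++ w) ≡ labels u ++ labels w
  labels-++ = map-++ toℕ

  tailLength : Word n → ℕ
  tailLength x = rgsTail (labels x)

  isStandard : Word n → Bool
  isStandard x = tailLength x ≡ᵇ 0

  tailLength-setPartition : ∀ r → 1 ≤ length r → IsSetPartition (labels r) → tailLength r ≢ 0
  tailLength-setPartition r nonempty = rgsTail-nonempty (labels r) (subst (1 ≤_) (sym (length-labels r)) nonempty)

  private
    allB-cong : ∀ {A : Set} {p q : A → Bool} xs → (∀ v → p v ≡ q v) → allB p xs ≡ allB q xs
    allB-cong []       _   = refl
    allB-cong (v ∷ xs) p≗q = cong₂ _∧_ (p≗q v) (allB-cong xs p≗q)

    ≡ᵇ-true⇒≡ : ∀ a b → (a ≡ᵇ b) ≡ true → a ≡ b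
    ≡ᵇ-true⇒≡ a b eq = ≡ᵇ⇒≡ a b (subst T (sym eq) _)

    true≢false : true ≢ false
    true≢false ()

    ≡ᵇ-refl : ∀ a → (a ≡ᵇ a) ≡ true
    ≡ᵇ-refl zero    = refl
    ≡ᵇ-refl (suc a) = ≡ᵇ-refl a

  -- Defs.compatible tests each pair with a local function; agrees recovers that test.
  agrees : Fin n × ℕ → Fin n × ℕ → Bool
  agrees u v = compatible (u ∷ v ∷ [])

  compatible-∷ : ∀ u rest → compatible (u ∷ rest) ≡ allB (agrees u) rest ∧ compatible rest
  compatible-∷ (x , a) rest =
    cong (_∧ compatible rest) (allB-cong rest (λ _ → sym (trans (∧-identityʳ _) (∧-identityʳ _))))

  agrees⇒ : ∀ x y a b → agrees (x , a) (y , b) ≡ true → (x ≡ y → a ≡ b) × (a ≡ b → x ≡ y)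
  agrees⇒ x y a b h with x Fin.≟ y | a ≡ᵇ b in a≡ᵇb
  ... | yes refl | true  = (λ _ → ≡ᵇ-true⇒≡ a b a≡ᵇb) , (λ _ → refl)
  ... | yes refl | false = ⊥-elim (true≢false (sym h))
  ... | no  x≢y  | true  = ⊥-elim (true≢false (sym h))
  ... | no  x≢y  | false = (⊥-elim ∘ x≢y) , (λ { refl → ⊥-elim (true≢false (trans (sym (≡ᵇ-refl a)) a≡ᵇb)) })

  agrees⇐ : ∀ x y a b → (x ≡ y → a ≡ b) → (a ≡ b → x ≡ y) → agrees (x , a) (y , b) ≡ true
  agrees⇐ x y a b to from with x Fin.≟ y | a ≡ᵇ b in a≡ᵇb
  ... | yes refl | true  = refl
  ... | yes refl | false = ⊥-elim (true≢false (trans (sym (subst (λ c → (a ≡ᵇ c) ≡ true) (to refl) (≡ᵇ-refl a))) a≡ᵇb))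
  ... | no  x≢y  | true  = ⊥-elim (x≢y (from (≡ᵇ-true⇒≡ a b a≡ᵇb)))
  ... | no  x≢y  | false = refl

  allB-agrees⇒ : ∀ x a w A → length w ≡ length A → allB (agrees (x , a)) (zip w A) ≡ true →
                 HeadAgrees (toℕ x) a (labels w) A
  allB-agrees⇒ x a []      []      _   _ j       = (λ ()) , (λ ())
  allB-agrees⇒ x a (y ∷ w) (b ∷ A) len h zero    =
    let to , from = agrees⇒ x y a b (∧-conicalˡ _ _ h) in
    (λ y≡x → cong just (sym (to (toℕ-injective (sym (just-injective y≡x)))))) ,
    (λ b≡a → cong just (cong toℕ (sym (from (sym (just-injective b≡a))))))
  allB-agrees⇒ x a (y ∷ w) (b ∷ A) len h (suc j) =
    allB-agrees⇒ x a w A (suc-injective len) (∧-conicalʳ _ _ h) j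

  allB-agrees⇐ : ∀ x a w A → length w ≡ length A → HeadAgrees (toℕ x) a (labels w) A →
                 allB (agrees (x , a)) (zip w A) ≡ true
  allB-agrees⇐ x a []      []      _   _ = refl
  allB-agrees⇐ x a (y ∷ w) (b ∷ A) len h = cong₂ _∧_
    (agrees⇐ x y a b (λ x≡y → sym (just-injective (proj₁ (h 0) (cong (just ∘ toℕ) (sym x≡y)))))
                     (λ a≡b → sym (toℕ-injective (just-injective (proj₂ (h 0) (cong just (sym a≡b)))))))
    (allB-agrees⇐ x a w A (suc-injective len) (h ∘ suc))

  compatible⇒SamePattern : ∀ w A → length w ≡ length A → compatible (zip w A) ≡ true →
                           SamePattern (labels w) A
  compatible⇒SamePattern []      []      _   _ = SamePattern-refl []
  compatible⇒SamePattern (x ∷ w) (a ∷ A) len h =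
    SamePattern-∷ (allB-agrees⇒ x a w A len′ (∧-conicalˡ _ _ h′))
                  (compatible⇒SamePattern w A len′ (∧-conicalʳ _ _ h′))
    where
    len′ : length w ≡ length A
    len′ = suc-injective len
    h′ : (allB (agrees (x , a)) (zip w A) ∧ compatible (zip w A)) ≡ true
    h′ = trans (sym (compatible-∷ (x , a) (zip w A))) h

  SamePattern⇒compatible : ∀ w A → SamePattern (labels w) A → compatible (zip w A) ≡ true
  SamePattern⇒compatible []      []      _    = refl
  SamePattern⇒compatible (x ∷ w) (a ∷ A) same =
    let head , same′ = SamePattern-∷⁻ same
        len′ = trans (sym (length-labels w)) (SamePattern.length≡ same′) in
    trans (compatible-∷ (x , a) (zip w A))
          (cong₂ _∧_ (allB-agrees⇐ x a w A len′ head) (SamePattern⇒compatible w A same′))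

  private
    transpose-injective : ∀ (i j : Fin n) {c d} → transpose i j c ≡ transpose i j d → c ≡ d
    transpose-injective i j {c} {d} eq =
      trans (sym (transpose-inverse j i)) (trans (cong (transpose j i) eq) (transpose-inverse j i))

    transpose-source : ∀ (i j : Fin n) → transpose i j i ≡ j
    transpose-source i j rewrite dec-true (i Fin.≟ i) refl = refl

    transpose-fixed : ∀ (i j : Fin n) {c} → c ≢ i → c ≢ j → transpose i j c ≡ c
    transpose-fixed i j {c} c≢i c≢j rewrite dec-false (c Fin.≟ i) c≢i | dec-false (c Fin.≟ j) c≢j = refl

  HeadAgrees-map : ∀ (g : Fin n → Fin n) → (∀ {c d} → g c ≡ g d → c ≡ d) → ∀ x w →
                   HeadAgrees (toℕ x) (toℕ (g x)) (labels w) (labels (map g w))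
  HeadAgrees-map g g-inj x []      j       = (λ ()) , (λ ())
  HeadAgrees-map g g-inj x (y ∷ w) zero    =
    (λ y≡x → cong (just ∘ toℕ ∘ g) (toℕ-injective (just-injective y≡x))) ,
    (λ gy≡gx → cong (just ∘ toℕ) (g-inj (toℕ-injective (just-injective gy≡gx))))
  HeadAgrees-map g g-inj x (y ∷ w) (suc j) = HeadAgrees-map g g-inj x w j

  SamePattern-map : ∀ (g : Fin n → Fin n) → (∀ {c d} → g c ≡ g d → c ≡ d) → ∀ w →
                    SamePattern (labels w) (labels (map g w))
  SamePattern-map g g-inj []      = SamePattern-refl []
  SamePattern-map g g-inj (x ∷ w) = SamePattern-∷ (HeadAgrees-map g g-inj x w) (SamePattern-map g g-inj w)

  fresh : ∀ {k} (c : Fin n) → ¬ toℕ c < k → Fin n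
  fresh c c≮k = fromℕ< (≤-<-trans (≮⇒≥ c≮k) (toℕ<n c))

  -- Scanning left to right, σ ∘ (letters read so far) is in restricted growth form with
  -- labels < k; a letter whose σ-image is new gets the label k by composing σ with a transposition.
  relabel : ℕ → (Fin n → Fin n) → Word n → Word n
  relabel k σ []      = []
  relabel k σ (x ∷ w) with toℕ (σ x) <? k
  ... | yes _   = σ x ∷ relabel k σ w
  ... | no σx≮k = fresh (σ x) σx≮k ∷ relabel (suc k) (transpose (σ x) (fresh (σ x) σx≮k) ∘ σ) w

  relabel-length : ∀ k σ w → length (relabel k σ w) ≡ length w
  relabel-length k σ []      = refl
  relabel-length k σ (x ∷ w) with toℕ (σ x) <? k
  ... | yes _ = cong suc (relabel-length k σ w)
  ... | no  _ = cong suc (relabel-length (suc k) _ w)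

  relabel-isRGS : ∀ k σ w → IsRGSFrom k (labels (relabel k σ w))
  relabel-isRGS k σ []      = _
  relabel-isRGS k σ (x ∷ w) with toℕ (σ x) <? k
  ... | yes σx<k = <⇒≤ σx<k ,
    subst (λ k′ → IsRGSFrom k′ (labels (relabel k σ w))) (sym (m≥n⇒m⊔n≡m σx<k)) (relabel-isRGS k σ w)
  ... | no  σx≮k = ≤-reflexive (toℕ-fromℕ< _) ,
    subst (λ k′ → IsRGSFrom k′ (labels (relabel (suc k) σ′ w)))
          (sym (trans (cong (λ l → k ⊔ suc l) (toℕ-fromℕ< _)) (m≤n⇒m⊔n≡n (n≤1+n k))))
          (relabel-isRGS (suc k) σ′ w)
    where
    σ′ : Fin n → Fin n
    σ′ = transpose (σ x) (fresh (σ x) σx≮k) ∘ σ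

  AllBelow : ℕ → Word n → Set
  AllBelow k = All (λ c → toℕ c < k)

  relabel-samePattern : ∀ k σ P w → AllBelow k P →
                        SamePattern (labels (P ++ map σ w)) (labels (P ++ relabel k σ w))
  relabel-samePattern k σ P []      below = SamePattern-refl _
  relabel-samePattern k σ P (x ∷ w) below with toℕ (σ x) <? k
  ... | yes σx<k = subst₂ (λ u v → SamePattern (labels u) (labels v))
                          (++-assoc P (σ x ∷ []) (map σ w)) (++-assoc P (σ x ∷ []) (relabel k σ w))
                          (relabel-samePattern k σ (P ++ σ x ∷ []) w (AllP.++⁺ below (σx<k ∷ [])))
  ... | no  σx≮k = SamePattern-trans transposed
                     (subst₂ (λ u v → SamePattern (labels u) (labels v))
                             (++-assoc P (f ∷ []) (map σ′ w)) (++-assoc P (f ∷ []) (relabel (suc k) σ′ w))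
                             (relabel-samePattern (suc k) σ′ (P ++ f ∷ []) w
                                (AllP.++⁺ (All.map (λ c<k → m<n⇒m<1+n c<k) below) (≤-reflexive (cong suc (toℕ-fromℕ< _)) ∷ []))))
    where
    f : Fin n
    f = fresh (σ x) σx≮k
    τ σ′ : Fin n → Fin n
    τ  = transpose (σ x) f
    σ′ = τ ∘ σ
    τ-fixes-P : map τ P ≡ P
    τ-fixes-P = map-id-local (All.map (λ c<k → transpose-fixed (σ x) f
                  (λ { refl → <⇒≱ c<k (≮⇒≥ σx≮k) }) (λ { refl → <-irrefl (toℕ-fromℕ< _) c<k })) below)
    transposed : SamePattern (labels (P ++ σ x ∷ map σ w)) (labels (P ++ f ∷ map σ′ w))
    transposed = subst (λ v → SamePattern (labels (P ++ σ x ∷ map σ w)) (labels v))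
      (trans (map-++ τ P (σ x ∷ map σ w)) (cong₂ _++_ τ-fixes-P (cong₂ _∷_ (transpose-source (σ x) f) (sym (map-∘ w)))))
      (SamePattern-map τ (transpose-injective (σ x) f) (P ++ σ x ∷ map σ w))

  standardize : Word n → Word n
  standardize = relabel 0 id

  standardize-length : ∀ w → length (standardize w) ≡ length w
  standardize-length = relabel-length 0 id

  standardize-isSetPartition : ∀ w → IsSetPartition (labels (standardize w))
  standardize-isSetPartition = relabel-isRGS 0 id

  standardize-samePattern : ∀ w → SamePattern (labels w) (labels (standardize w))
  standardize-samePattern w =
    subst (λ v → SamePattern (labels v) (labels (standardize w))) (map-id w) (relabel-samePattern 0 id [] w [])

  -- w read as a base-n numeral: its rank among the words of its length in lexicographic order.
  code : Word n → ℕ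
  code []      = 0
  code (x ∷ w) = toℕ x * n ^ length w + code w

  code< : ∀ w → code w < n ^ length w
  code-∷< : ∀ x w → code (x ∷ w) < suc (toℕ x) * n ^ length w

  code< []      = s≤s z≤n
  code< (x ∷ w) = <-≤-trans (code-∷< x w) (*-monoˡ-≤ (n ^ length w) (toℕ<n x))

  code-∷< x w = begin-strict
    toℕ x * n ^ length w + code w        <⟨ +-monoʳ-< (toℕ x * n ^ length w) (code< w) ⟩
    toℕ x * n ^ length w + n ^ length w  ≡⟨ +-comm (toℕ x * n ^ length w) _ ⟩
    suc (toℕ x) * n ^ length w           ∎
    where open ≤-Reasoning

  <ₗₑₓ⇒code< : ∀ u w → length u ≡ length w → labels u <ₗₑₓ labels w → code u < code w
  <ₗₑₓ⇒code< (x ∷ u) (y ∷ w) len (inj₁ x<y) = begin-strict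
    code (x ∷ u)                   <⟨ code-∷< x u ⟩
    suc (toℕ x) * n ^ length u     ≤⟨ *-monoˡ-≤ (n ^ length u) x<y ⟩
    toℕ y * n ^ length u           ≡⟨ cong (λ l → toℕ y * n ^ l) (suc-injective len) ⟩
    toℕ y * n ^ length w           ≤⟨ m≤m+n _ (code w) ⟩
    code (y ∷ w)                   ∎
    where open ≤-Reasoning
  <ₗₑₓ⇒code< (x ∷ u) (y ∷ w) len (inj₂ (x≡y , lt)) rewrite suc-injective len | toℕ-injective x≡y =
    +-monoʳ-< (toℕ y * n ^ length w) (<ₗₑₓ⇒code< u w (suc-injective len) lt)

  code-rec : (P : Word n → Set) → (∀ x → (∀ y → code y < code x → P y) → P x) → ∀ x → P x
  code-rec P step = WF.All.wfRec (On.wellFounded code <-wellFounded) 0ℓ P (λ x ih → step x (λ y → ih))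

  code-rec-downward : ∀ j (P : Word n → Set) →
                      (∀ x → length x ≡ j → (∀ y → length y ≡ j → code x < code y → P y) → P x) →
                      ∀ x → length x ≡ j → P x
  code-rec-downward j P step =
    WF.All.wfRec (On.wellFounded (λ x → n ^ j ∸ code x) <-wellFounded) 0ℓ (λ x → length x ≡ j → P x)
      (λ x ih len → step x len (λ y len-y x<y →
         ih (∸-monoʳ-< x<y (<⇒≤ (subst (λ l → code y < n ^ l) len-y (code< y)))) len-y))

module ℚSums = Sums (IsCommutativeRing.isCommutativeSemiring ℚP.+-*-isCommutativeRing)

module Coefficients (n : ℕ) where

  open import Data.Nat using () renaming (_+_ to _+ℕ_)
  open import Data.List using (List; []; _∷_; _++_; map; length; zip)
  open import Data.List.Properties using (length-++; ++-cancelˡ; ++-identityʳ)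
  open import Data.Rational using (ℚ; 0ℚ; 1ℚ; _+_; _*_)
  open import Data.Product using (_×_; _,_; proj₁; proj₂)
  open import Relation.Nullary using (yes; no; ⌊_⌋)
  open import Data.Empty using (⊥-elim)
  open import Function using (_∘_)
  open import Relation.Binary.PropositionalEquality
  open import Defs
  open ℚSums public
  open WordSums n public

  δ : Word n → Word n → ℚ
  δ x w = [ ⌊ x ≟ʷ w ⌋ ]· 1ℚ

  δ-≢ : ∀ {x w} → x ≢ w → δ x w ≡ 0ℚ
  δ-≢ {x} {w} x≢w with x ≟ʷ w
  ... | yes x≡w = ⊥-elim (x≢w x≡w)
  ... | no  _   = refl

  δ-refl : ∀ x → δ x x ≡ 1ℚ
  δ-refl x with x ≟ʷ x
  ... | yes _   = refl
  ... | no  x≢x = ⊥-elim (x≢x refl)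

  δ-* : ∀ x y r → δ x y * r ≡ [ ⌊ x ≟ʷ y ⌋ ]· r
  δ-* x y r with x ≟ʷ y
  ... | yes _ = ℚP.*-identityˡ r
  ... | no  _ = ℚP.*-zeroˡ r

  δ-++ˡ : ∀ u z s → δ (u ++ z) (u ++ s) ≡ δ z s
  δ-++ˡ u z s with z ≟ʷ s
  ... | yes refl = δ-refl (u ++ z)
  ... | no  z≢s  = δ-≢ (z≢s ∘ ++-cancelˡ u z s)

  termCoeff : Word n → Word n → ℚ × Word n → ℚ
  termCoeff u w (d , v) = [ ⌊ u ++ v ≟ʷ w ⌋ ]· d

  -- coefficient of w in u · g
  prefixCoeff : Word n → Poly n → Word n → ℚ
  prefixCoeff u g w = Σl (termCoeff u w) g

  coeff≡prefixCoeff[] : ∀ (p : Poly n) w → coeff p w ≡ prefixCoeff [] p w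
  coeff≡prefixCoeff[] []            w = refl
  coeff≡prefixCoeff[] ((c , u) ∷ p) w = cong ([ ⌊ u ≟ʷ w ⌋ ]· c +_) (coeff≡prefixCoeff[] p w)

  prefixCoeff-++ : ∀ u (p q : Poly n) w → prefixCoeff u (p ++ q) w ≡ prefixCoeff u p w + prefixCoeff u q w
  prefixCoeff-++ u p q w = Σl-++ (termCoeff u w) p q

  coeff-++ : ∀ (p q : Poly n) w → coeff (p ++ q) w ≡ coeff p w + coeff q w
  coeff-++ p q w = begin
    coeff (p ++ q) w                         ≡⟨ coeff≡prefixCoeff[] (p ++ q) w ⟩
    prefixCoeff [] (p ++ q) w                ≡⟨ prefixCoeff-++ [] p q w ⟩
    prefixCoeff [] p w + prefixCoeff [] q w  ≡⟨ cong₂ _+_ (coeff≡prefixCoeff[] p w) (coeff≡prefixCoeff[] q w) ⟨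
    coeff p w + coeff q w                    ∎
    where open ≡-Reasoning

  coeff-scale : ∀ q (p : Poly n) w → coeff (scale q p) w ≡ q * coeff p w
  coeff-scale q []            w = sym (ℚP.*-zeroʳ q)
  coeff-scale q ((c , u) ∷ p) w =
    trans (cong₂ _+_ ([]·-*ʳ ⌊ u ≟ʷ w ⌋ q c) (coeff-scale q p w)) (sym (ℚP.*-distribˡ-+ q _ _))

  prefixCoeff-scale : ∀ u q (p : Poly n) w → prefixCoeff u (scale q p) w ≡ q * prefixCoeff u p w
  prefixCoeff-scale u q []            w = sym (ℚP.*-zeroʳ q)
  prefixCoeff-scale u q ((c , v) ∷ p) w =
    trans (cong₂ _+_ ([]·-*ʳ ⌊ u ++ v ≟ʷ w ⌋ q c) (prefixCoeff-scale u q p w)) (sym (ℚP.*-distribˡ-+ q _ _))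

  coeff-⊗ : ∀ (f g : Poly n) w → coeff (f ⊗ g) w ≡ Σl (λ t → proj₁ t * prefixCoeff (proj₂ t) g w) f
  coeff-⊗ []            g w = refl
  coeff-⊗ ((c , u) ∷ f) g w =
    trans (coeff-++ (map (λ { (d , v) → (c * d , u ++ v) }) g) (f ⊗ g) w)
          (cong₂ _+_ (shifted g) (coeff-⊗ f g w))
    where
    shifted : ∀ g → coeff (map (λ { (d , v) → (c * d , u ++ v) }) g) w ≡ c * prefixCoeff u g w
    shifted []            = sym (ℚP.*-zeroʳ c)
    shifted ((d , v) ∷ g) =
      trans (cong₂ _+_ ([]·-*ʳ ⌊ u ++ v ≟ʷ w ⌋ c d) (shifted g)) (sym (ℚP.*-distribˡ-+ c _ _))

  -- coefficient of w in u · m_A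
  monomialCoeff : Word n → List ℕ → Word n → ℚ
  monomialCoeff u A w = ΣW (length A) (λ y → [ compatible (zip y A) ]· δ (u ++ y) w)

  prefixCoeff-monomialNC : ∀ u A w → prefixCoeff u (monomialNC n A) w ≡ monomialCoeff u A w
  prefixCoeff-monomialNC u A w =
    trans (Σl-map (termCoeff u w) (λ y → (1ℚ , y)) (filterB (λ y → compatible (zip y A)) (allWords n (length A))))
          (Σl-filterB (λ y → compatible (zip y A)) (λ y → δ (u ++ y) w) (allWords n (length A)))

  monomialCoeff-[] : ∀ u w → monomialCoeff u [] w ≡ δ u w
  monomialCoeff-[] u w = trans (ℚP.+-identityʳ _) (cong (λ v → δ v w) (++-identityʳ u))

  monomialCoeff-length : ∀ u A w → length w ≢ length u +ℕ length A → monomialCoeff u A w ≡ 0ℚ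
  monomialCoeff-length u A w len≢ = trans (ΣW-cong (length A) vanish) (Σl-zero (allWords n (length A)))
    where
    vanish : ∀ y → length y ≡ length A → [ compatible (zip y A) ]· δ (u ++ y) w ≡ 0ℚ
    vanish y len = trans (cong ([ compatible (zip y A) ]·_)
                            (δ-≢ (λ { refl → len≢ (trans (length-++ u) (cong (length u +ℕ_) len)) })))
                       ([]·-0 (compatible (zip y A)))

module Span (n k : ℕ) where

  open import Data.Nat as ℕ using (_≤_; _<_; _∸_; _≡ᵇ_; s≤s) renaming (_+_ to _+ℕ_)
  open import Data.Bool using (true; false; not)
  open import Data.List using ([]; _∷_; _++_; length; take; drop; zip)
  open import Data.List.Properties
    using (length-++; take++drop≡id; drop-map)
  open import Data.List.Relation.Unary.All as All using (All; []; _∷_)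
  open import Data.Rational using (ℚ; 0ℚ; 1ℚ; _+_; _*_; -_; _-_)
  open import Data.Product using (Σ-syntax; _×_; _,_; proj₁)
  open import Data.Sum using (_⊎_; inj₁; inj₂)
  open import Data.Empty using (⊥-elim)
  open import Function using (case_of_)
  open import Relation.Nullary using (yes; no; ⌊_⌋)
  open import Relation.Binary.PropositionalEquality
  open import Defs
  open ListLemmas
  open Patterns
  open Words n
  open Coefficients n

  rgsPrefix rgsSuffix : Word n → Word n
  rgsPrefix x = take (length x ∸ tailLength x) x
  rgsSuffix x = drop (length x ∸ tailLength x) x

  rgsPrefix++rgsSuffix : ∀ x → rgsPrefix x ++ rgsSuffix x ≡ x
  rgsPrefix++rgsSuffix x = take++drop≡id (length x ∸ tailLength x) x

  nonstandard⇒tailLength≢0 : ∀ x → isStandard x ≡ false → tailLength x ≢ 0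
  nonstandard⇒tailLength≢0 x nonstd tail≡0 with trans (sym (cong (_≡ᵇ 0) tail≡0)) nonstd
  ... | ()

  rgsSuffix-spec : ∀ x → isStandard x ≡ false →
                             IsSetPartition (labels (rgsSuffix x)) × length (rgsSuffix x) ≡ tailLength x
  rgsSuffix-spec x nonstd
    with rgsTail-suffix (labels x) (nonstandard⇒tailLength≢0 x nonstd)
  ... | us , as , labels≡ , len , rgs = subst IsSetPartition (sym suffix≡) rgs ,
                                        trans (sym (length-labels (rgsSuffix x))) (trans (cong length suffix≡) len)
    where
    cut≡ : length x ∸ tailLength x ≡ length us
    cut≡ = trans (cong₂ _∸_ (trans (sym (length-labels x)) (trans (cong length labels≡) (length-++ us))) (sym len))
                 (ℕP.m+n∸n≡m (length us) (length as))
    suffix≡ : labels (rgsSuffix x) ≡ as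
    suffix≡ = trans (sym (drop-map (length x ∸ tailLength x) x))
                    (trans (cong₂ drop cut≡ labels≡) (drop-++-length us as refl))

  rgsSplit-++ : ∀ u r → rgsTail (labels r) ≡ length r → 1 ≤ length r →
                 rgsPrefix (u ++ r) ≡ u × rgsSuffix (u ++ r) ≡ r × isStandard (u ++ r) ≡ false
  rgsSplit-++ u r full nonempty = prefix≡ , suffix≡ , nonstd
    where
    tail≡ : tailLength (u ++ r) ≡ length r
    tail≡ = trans (cong rgsTail (labels-++ u r))
                  (trans (rgsTail-++ (labels u) (λ tail≡0 → ℕP.<⇒≢ nonempty (sym (trans (sym full) tail≡0)))) full)
    cut≡ : length (u ++ r) ∸ tailLength (u ++ r) ≡ length u
    cut≡ = trans (cong₂ _∸_ (length-++ u) tail≡) (ℕP.m+n∸n≡m (length u) (length r))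
    prefix≡ : rgsPrefix (u ++ r) ≡ u
    prefix≡ = trans (cong (λ c → take c (u ++ r)) cut≡) (take-++-length u r refl)
    suffix≡ : rgsSuffix (u ++ r) ≡ r
    suffix≡ = trans (cong (λ c → drop c (u ++ r)) cut≡) (drop-++-length u r refl)
    nonstd : isStandard (u ++ r) ≡ false
    nonstd = trans (cong (_≡ᵇ 0) tail≡) (positive≡ᵇ0 nonempty)
      where
      positive≡ᵇ0 : ∀ {m} → 1 ≤ m → (m ≡ᵇ 0) ≡ false
      positive≡ᵇ0 (s≤s _) = refl

  rgsPrefix-++-length : ∀ x z → length (rgsPrefix x ++ z) ≡ length x → length z ≡ length (rgsSuffix x)
  rgsPrefix-++-length x z len = ℕP.+-cancelˡ-≡ (length u) _ _ (begin
    length u +ℕ length z               ≡⟨ length-++ u ⟨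
    length (u ++ z)                    ≡⟨ len ⟩
    length x                           ≡⟨ cong length (rgsPrefix++rgsSuffix x) ⟨
    length (u ++ rgsSuffix x)          ≡⟨ length-++ u ⟩
    length u +ℕ length (rgsSuffix x)   ∎)
    where
    open ≡-Reasoning
    u : Word n
    u = rgsPrefix x

  -- coefficients of rgsPrefix x · m_(rgsSuffix x)
  generator : Word n → Word n → ℚ
  generator x = monomialCoeff (rgsPrefix x) (labels (rgsSuffix x))

  generator-leading : ∀ x → isStandard x ≡ false → generator x x ≡ 1ℚ
  generator-leading x nonstd = begin
    monomialCoeff u (labels s) x
      ≡⟨ cong (monomialCoeff u (labels s)) (sym (rgsPrefix++rgsSuffix x)) ⟩
    ΣW (length (labels s)) (λ z → [ compatible (zip z (labels s)) ]· δ (u ++ z) (u ++ s))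
      ≡⟨ ΣW-cong (length (labels s)) (λ z _ → trans (cong ([ compatible (zip z (labels s)) ]·_) (δ-++ˡ u z s))
                                                   ([]·-comm (compatible (zip z (labels s))) ⌊ z ≟ʷ s ⌋ 1ℚ)) ⟩
    ΣW (length (labels s)) (λ z → [ ⌊ z ≟ʷ s ⌋ ]· [ compatible (zip z (labels s)) ]· 1ℚ)
      ≡⟨ ΣW-indicator (λ z → [ compatible (zip z (labels s)) ]· 1ℚ) s (sym (length-labels s)) ⟩
    [ compatible (zip s (labels s)) ]· 1ℚ
      ≡⟨ cong ([_]· 1ℚ) (SamePattern⇒compatible s (labels s) (SamePattern-refl (labels s))) ⟩
    1ℚ  ∎
    where
    open ≡-Reasoning
    u s : Word n
    u = rgsPrefix x
    s = rgsSuffix x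

  suffix-lexLeast : ∀ y z → isStandard y ≡ false → length z ≡ length (rgsSuffix y) →
                    compatible (zip z (labels (rgsSuffix y))) ≡ true →
                    z ≡ rgsSuffix y ⊎ code y < code (rgsPrefix y ++ z)
  suffix-lexLeast y z nonstd len compat
    with rgs-lexLeast (proj₁ (rgsSuffix-spec y nonstd))
                      (compatible⇒SamePattern z (labels (rgsSuffix y)) (trans len (sym (length-labels (rgsSuffix y)))) compat)
  ... | inj₁ labels≡ = inj₁ (sym (labels-injective labels≡))
  ... | inj₂ lt      = inj₂ (<ₗₑₓ⇒code< y (u ++ z) len-y
                               (subst₂ _<ₗₑₓ_ labels-y (sym (labels-++ u z)) (<ₗₑₓ-++ (labels u) lt)))
    where
    open ≡-Reasoning
    u s : Word n
    u = rgsPrefix y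
    s = rgsSuffix y
    labels-y : labels u ++ labels s ≡ labels y
    labels-y = trans (sym (labels-++ u s)) (cong labels (rgsPrefix++rgsSuffix y))
    len-y : length y ≡ length (u ++ z)
    len-y = begin
      length y              ≡⟨ cong length (rgsPrefix++rgsSuffix y) ⟨
      length (u ++ s)       ≡⟨ length-++ u ⟩
      length u +ℕ length s  ≡⟨ cong (length u +ℕ_) len ⟨
      length u +ℕ length z  ≡⟨ length-++ u ⟨
      length (u ++ z)       ∎

  generator-lower : ∀ y w → isStandard y ≡ false → length w ≡ length y → code w < code y → generator y w ≡ 0ℚ
  generator-lower y w nonstd len w<y =
    trans (ΣW-cong (length (labels s)) vanish) (Σl-zero (allWords n (length (labels s))))
    where
    u s : Word n
    u = rgsPrefix y
    s = rgsSuffix y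
    vanish : ∀ z → length z ≡ length (labels s) → [ compatible (zip z (labels s)) ]· δ (u ++ z) w ≡ 0ℚ
    vanish z len-z with compatible (zip z (labels s)) in compat
    ... | false = refl
    ... | true  = δ-≢ λ { refl → case suffix-lexLeast y z nonstd (trans len-z (length-labels s)) compat of λ
                    { (inj₁ refl) → ℕP.<-irrefl (cong code (rgsPrefix++rgsSuffix y)) w<y
                    ; (inj₂ y<w)  → ℕP.<-asym w<y y<w } }

  combination : (Word n → ℚ) → Word n → ℚ
  combination a w = ΣW k (λ x → [ not (isStandard x) ]· (a x * generator x w))

  InSpan : (Word n → ℚ) → Set
  InSpan g = Σ[ a ∈ (Word n → ℚ) ] (∀ w → length w ≡ k → g w ≡ combination a w)

  InSpan-cong : ∀ {g h} → (∀ w → length w ≡ k → g w ≡ h w) → InSpan g → InSpan h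
  InSpan-cong g≗h (a , g≡) = a , λ w len → trans (sym (g≗h w len)) (g≡ w len)

  InSpan-zero : ∀ {g} → (∀ w → length w ≡ k → g w ≡ 0ℚ) → InSpan g
  InSpan-zero g≡0 = (λ _ → 0ℚ) , λ w len → trans (g≡0 w len) (sym (trans
    (ΣW-cong k (λ x _ → trans (cong ([ not (isStandard x) ]·_) (ℚP.*-zeroˡ (generator x w))) ([]·-0 _)))
    (Σl-zero (allWords n k))))

  InSpan-+ : ∀ {g h} → InSpan g → InSpan h → InSpan (λ w → g w + h w)
  InSpan-+ {g} {h} (a , g≡) (b , h≡) = (λ x → a x + b x) , λ w len → begin
    g w + h w                          ≡⟨ cong₂ _+_ (g≡ w len) (h≡ w len) ⟩
    combination a w + combination b w  ≡⟨ Σl-+ _ _ (allWords n k) ⟨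
    ΣW k (λ x → [ not (isStandard x) ]· (a x * generator x w) + [ not (isStandard x) ]· (b x * generator x w))
      ≡⟨ ΣW-cong k (λ x _ → trans (sym ([]·-+ (not (isStandard x)) _ _))
                                 (cong ([ not (isStandard x) ]·_) (sym (ℚP.*-distribʳ-+ (generator x w) (a x) (b x))))) ⟩
    combination (λ x → a x + b x) w    ∎
    where open ≡-Reasoning

  InSpan-* : ∀ c {g} → InSpan g → InSpan (λ w → c * g w)
  InSpan-* c {g} (a , g≡) = (λ x → c * a x) , λ w len → begin
    c * g w               ≡⟨ cong (c *_) (g≡ w len) ⟩
    c * combination a w   ≡⟨ Σl-*ˡ c _ (allWords n k) ⟨
    ΣW k (λ x → c * [ not (isStandard x) ]· (a x * generator x w))
      ≡⟨ ΣW-cong k (λ x _ → trans (sym ([]·-*ʳ (not (isStandard x)) c _))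
                                 (cong ([ not (isStandard x) ]·_) (sym (ℚP.*-assoc c (a x) (generator x w))))) ⟩
    combination (λ x → c * a x) w  ∎
    where open ≡-Reasoning

  InSpan-sub : ∀ {g h} → InSpan g → InSpan h → InSpan (λ w → g w - h w)
  InSpan-sub {g} {h} g∈ h∈ =
    InSpan-cong (λ w _ → cong (g w +_) (trans (sym (ℚP.neg-distribˡ-* 1ℚ (h w))) (cong -_ (ℚP.*-identityˡ (h w)))))
                                       (InSpan-+ g∈ (InSpan-* (- 1ℚ) h∈))

  InSpan-[]· : ∀ b {g} → InSpan g → InSpan (λ w → [ b ]· g w)
  InSpan-[]· true  g∈ = g∈
  InSpan-[]· false g∈ = InSpan-zero (λ _ _ → refl)

  InSpan-Σl : ∀ {X : Set} {P : X → Set} {xs} (h : X → Word n → ℚ) → All P xs →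
              (∀ e → P e → InSpan (h e)) → InSpan (λ w → Σl (λ e → h e w) xs)
  InSpan-Σl h []       h∈ = InSpan-zero (λ _ _ → refl)
  InSpan-Σl h (p ∷ ps) h∈ = InSpan-+ (h∈ _ p) (InSpan-Σl h ps h∈)

  InSpan-ΣW : ∀ j (h : Word n → Word n → ℚ) → (∀ e → length e ≡ j → InSpan (h e)) →
              InSpan (λ w → ΣW j (λ e → h e w))
  InSpan-ΣW j h h∈ = InSpan-Σl h (allWords-length j) h∈

  InSpan-generator : ∀ x → length x ≡ k → isStandard x ≡ false → InSpan (generator x)
  InSpan-generator x₀ len nonstd = (λ x → δ x x₀) , λ w _ → sym (begin
    ΣW k (λ x → [ not (isStandard x) ]· (δ x x₀ * generator x w))
      ≡⟨ ΣW-cong k (λ x _ → trans (cong ([ not (isStandard x) ]·_) (δ-* x x₀ _))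
                                 ([]·-comm (not (isStandard x)) ⌊ x ≟ʷ x₀ ⌋ (generator x w))) ⟩
    ΣW k (λ x → [ ⌊ x ≟ʷ x₀ ⌋ ]· ([ not (isStandard x) ]· generator x w))
      ≡⟨ ΣW-indicator (λ x → [ not (isStandard x) ]· generator x w) x₀ len ⟩
    [ not (isStandard x₀) ]· generator x₀ w
      ≡⟨ cong (λ b → [ not b ]· generator x₀ w) nonstd ⟩
    generator x₀ w  ∎)
    where open ≡-Reasoning

  combination-coefficients-vanish :
    ∀ a → (∀ x → length x ≡ k → isStandard x ≡ false → combination a x ≡ 0ℚ) →
    ∀ x → length x ≡ k → isStandard x ≡ false → a x ≡ 0ℚ
  combination-coefficients-vanish a comb≡0 = code-rec _ step
    where
    step : ∀ x → (∀ y → code y < code x → length y ≡ k → isStandard y ≡ false → a y ≡ 0ℚ) →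
           length x ≡ k → isStandard x ≡ false → a x ≡ 0ℚ
    step x ih len nonstd = trans (sym (ΣW-indicator a x len)) (trans (sym (ΣW-cong k term)) (comb≡0 x len nonstd))
      where
      term : ∀ y → length y ≡ k → [ not (isStandard y) ]· (a y * generator y x) ≡ [ ⌊ y ≟ʷ x ⌋ ]· a y
      term y len-y with y ≟ʷ x
      ... | yes refl rewrite nonstd = trans (cong (a x *_) (generator-leading x nonstd)) (ℚP.*-identityʳ (a x))
      ... | no  y≢x with isStandard y in std-y
      ...   | true  = refl
      ...   | false with <ₗₑₓ-trichotomy (labels y) (labels x)
                           (trans (length-labels y) (trans len-y (trans (sym len) (sym (length-labels x)))))
      ...     | inj₁ labels≡   = ⊥-elim (y≢x (labels-injective labels≡))
      ...     | inj₂ (inj₁ y<x) = trans (cong (_* generator y x) (ih y (<ₗₑₓ⇒code< y x (trans len-y (sym len)) y<x) len-y std-y))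
                                        (ℚP.*-zeroˡ (generator y x))
      ...     | inj₂ (inj₂ x<y) = trans (cong (a y *_) (generator-lower y x std-y (trans len (sym len-y))
                                                          (<ₗₑₓ⇒code< x y (trans len (sym len-y)) x<y)))
                                        (ℚP.*-zeroʳ (a y))

  InSpan-vanishing : ∀ {g} → InSpan g → (∀ x → length x ≡ k → isStandard x ≡ false → g x ≡ 0ℚ) →
                     ∀ w → length w ≡ k → g w ≡ 0ℚ
  InSpan-vanishing (a , g≡) g≡0 w len = trans (g≡ w len) (trans (ΣW-cong k term) (Σl-zero (allWords n k)))
    where
    a≡0 : ∀ x → length x ≡ k → isStandard x ≡ false → a x ≡ 0ℚ
    a≡0 = combination-coefficients-vanish a (λ x len-x nonstd → trans (sym (g≡ x len-x)) (g≡0 x len-x nonstd))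
    term : ∀ x → length x ≡ k → [ not (isStandard x) ]· (a x * generator x w) ≡ 0ℚ
    term x len-x with isStandard x in std-x
    ... | true  = refl
    ... | false = trans (cong (_* generator x w) (a≡0 x len-x std-x)) (ℚP.*-zeroˡ (generator x w))

module IdealIsSpan (n k : ℕ) where

  open import Data.Nat as ℕ using (_∸_; _≤_; _<_; z≤n; s≤s) renaming (_+_ to _+ℕ_)
  open import Data.Bool.Properties using (∧-conicalˡ; ∧-conicalʳ; not-involutive)
  open import Data.Nat.Induction using (<-rec)
  open import Data.Bool using (Bool; true; false; not; _∧_)
  open import Data.List using (List; []; _∷_; _++_; map; length; take; drop; zip; foldr)
  open import Data.Unit using (tt)
  open import Data.List.Properties
    using (length-++; take++drop≡id; drop-map; take-map; length-take; length-drop; ++-assoc)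
  open import Data.List.Relation.Unary.All as All using (All; []; _∷_)
  open import Data.Rational using (ℚ; 0ℚ; 1ℚ; _+_; _*_; -_; _-_)
  open import Data.Product using (_×_; _,_; proj₁; proj₂)
  open import Data.Sum using (inj₁; inj₂)
  open import Data.Empty using (⊥-elim)
  open import Function using (_∘_)
  open import Relation.Nullary using (yes; no; ⌊_⌋)
  open import Relation.Binary.PropositionalEquality
  open import Defs
  open import Data.Rational.Solver using (module +-*-Solver)
  open +-*-Solver using (solve; _:=_; _:+_; _:*_; _:-_; :-_; con)
  open import Data.Fin using (toℕ)
  open ListLemmas
  open Patterns
  open Words n
  open Coefficients n
  open Span n k

  private
    Bool-≡ : ∀ {b₁ b₂ : Bool} → (b₁ ≡ true → b₂ ≡ true) → (b₂ ≡ true → b₁ ≡ true) → b₁ ≡ b₂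
    Bool-≡ {true}  {true}  _  _  = refl
    Bool-≡ {true}  {false} to _  = sym (to refl)
    Bool-≡ {false} {true}  _  from = from refl
    Bool-≡ {false} {false} _  _  = refl

  hasPattern : Word n → Word n → Bool
  hasPattern z ρ = compatible (zip z (labels ρ))

  isRGS : Word n → Bool
  isRGS ρ = isSetPartitionᵇ (labels ρ)

  hasPattern⇒SamePattern : ∀ z ρ → length z ≡ length ρ → hasPattern z ρ ≡ true → SamePattern (labels z) (labels ρ)
  hasPattern⇒SamePattern z ρ len = compatible⇒SamePattern z (labels ρ) (trans len (sym (length-labels ρ)))

  compatible-cong : ∀ a b A → length a ≡ length A → SamePattern (labels a) (labels b) →
                    compatible (zip a A) ≡ compatible (zip b A)
  compatible-cong a b A len same = Bool-≡
    (λ a~A → SamePattern⇒compatible b A (SamePattern-trans (SamePattern-sym same) (compatible⇒SamePattern a A len a~A)))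
    (λ b~A → SamePattern⇒compatible a A (SamePattern-trans same (compatible⇒SamePattern b A len′ b~A)))
    where
    len′ : length b ≡ length A
    len′ = trans (sym (length-labels b)) (trans (sym (SamePattern.length≡ same)) (trans (length-labels a) len))

  hasPattern-refl : ∀ z → hasPattern z z ≡ true
  hasPattern-refl z = SamePattern⇒compatible z (labels z) (SamePattern-refl (labels z))

  isRGS∧hasPattern : ∀ z ρ → length z ≡ length ρ → (isRGS ρ ∧ hasPattern z ρ) ≡ ⌊ ρ ≟ʷ standardize z ⌋
  isRGS∧hasPattern z ρ len with ρ ≟ʷ standardize z
  ... | yes refl = cong₂ _∧_ (isSetPartitionᵇ-complete (standardize-isSetPartition z))
                             (SamePattern⇒compatible z _ (standardize-samePattern z))
  ... | no  ρ≢ with isRGS ρ in rgs | hasPattern z ρ in z~ρ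
  ...   | false | _     = refl
  ...   | true  | false = refl
  ...   | true  | true  = ⊥-elim (ρ≢ (labels-injective (rgs-unique (isSetPartitionᵇ-sound _ rgs) (standardize-isSetPartition z)
                            (SamePattern-trans (SamePattern-sym (hasPattern⇒SamePattern z ρ len z~ρ)) (standardize-samePattern z)))))

  -- Every word has exactly one restricted-growth word of its pattern, namely its standardization.
  ΣW-byPattern : ∀ j (Q : Word n → Bool) (F : Word n → ℚ) →
                 (∀ z ρ → length z ≡ j → length ρ ≡ j → hasPattern z ρ ≡ true → Q z ≡ Q ρ) →
                 ΣW j (λ z → [ Q z ]· F z) ≡ ΣW j (λ ρ → [ isRGS ρ ]· [ Q ρ ]· ΣW j (λ z → [ hasPattern z ρ ]· F z))
  ΣW-byPattern j Q F Q-invariant = sym (begin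
    ΣW j (λ ρ → [ isRGS ρ ]· [ Q ρ ]· ΣW j (λ z → [ hasPattern z ρ ]· F z))
      ≡⟨ ΣW-cong j (λ ρ _ → trans (cong ([ isRGS ρ ]·_) ([]·-Σl (Q ρ) _ (allWords n j))) ([]·-Σl (isRGS ρ) _ (allWords n j))) ⟩
    ΣW j (λ ρ → ΣW j (λ z → [ isRGS ρ ]· [ Q ρ ]· [ hasPattern z ρ ]· F z))
      ≡⟨ Σl-swap (λ ρ z → [ isRGS ρ ]· [ Q ρ ]· [ hasPattern z ρ ]· F z) (allWords n j) (allWords n j) ⟩
    ΣW j (λ z → ΣW j (λ ρ → [ isRGS ρ ]· [ Q ρ ]· [ hasPattern z ρ ]· F z))
      ≡⟨ ΣW-cong j (λ z len-z → trans (ΣW-cong j (λ ρ len-ρ → pick z ρ len-z len-ρ))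
                                      (ΣW-indicator (λ _ → [ Q z ]· F z) (standardize z) (trans (standardize-length z) len-z))) ⟩
    ΣW j (λ z → [ Q z ]· F z)  ∎)
    where
    open ≡-Reasoning
    pick : ∀ z ρ → length z ≡ j → length ρ ≡ j →
           [ isRGS ρ ]· [ Q ρ ]· [ hasPattern z ρ ]· F z ≡ [ ⌊ ρ ≟ʷ standardize z ⌋ ]· [ Q z ]· F z
    pick z ρ len-z len-ρ = begin
      [ isRGS ρ ]· [ Q ρ ]· [ hasPattern z ρ ]· F z   ≡⟨ cong ([ isRGS ρ ]·_) ([]·-comm (Q ρ) (hasPattern z ρ) (F z)) ⟩
      [ isRGS ρ ]· [ hasPattern z ρ ]· [ Q ρ ]· F z   ≡⟨ []·-∧ (isRGS ρ) (hasPattern z ρ) _ ⟨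
      [ isRGS ρ ∧ hasPattern z ρ ]· [ Q ρ ]· F z      ≡⟨ cong ([_]· [ Q ρ ]· F z) (isRGS∧hasPattern z ρ (trans len-z (sym len-ρ))) ⟩
      [ ⌊ ρ ≟ʷ standardize z ⌋ ]· [ Q ρ ]· F z        ≡⟨ representative ⟩
      [ ⌊ ρ ≟ʷ standardize z ⌋ ]· [ Q z ]· F z        ∎
      where
      representative : [ ⌊ ρ ≟ʷ standardize z ⌋ ]· [ Q ρ ]· F z ≡ [ ⌊ ρ ≟ʷ standardize z ⌋ ]· [ Q z ]· F z
      representative with ρ ≟ʷ standardize z
      ... | yes refl = cong ([_]· F z) (sym (Q-invariant z ρ len-z len-ρ
                         (SamePattern⇒compatible z (labels ρ) (standardize-samePattern z))))
      ... | no  _    = refl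

  module Product (u r₁ r₂ : Word n) where

    p m : ℕ
    p = length r₁
    m = length r₂

    Q : Word n → Bool
    Q z = hasPattern (take p z) r₁ ∧ hasPattern (drop p z) r₂

    length-take-p : ∀ (z : Word n) → length z ≡ p +ℕ m → length (take p z) ≡ p
    length-take-p z len = trans (length-take p z) (trans (cong (p ℕ.⊓_) len) (ℕP.m≤n⇒m⊓n≡m (ℕP.m≤m+n p m)))

    length-drop-p : ∀ (z : Word n) → length z ≡ p +ℕ m → length (drop p z) ≡ m
    length-drop-p z len = trans (length-drop p z) (trans (cong (_∸ p) len) (ℕP.m+n∸m≡n p m))

    Q-invariant : ∀ (z ρ : Word n) → length z ≡ p +ℕ m → length ρ ≡ p +ℕ m → hasPattern z ρ ≡ true → Q z ≡ Q ρ
    Q-invariant z ρ len-z len-ρ z~ρ = cong₂ _∧_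
      (compatible-cong (take p z) (take p ρ) (labels r₁) (trans (length-take-p z len-z) (sym (length-labels r₁)))
        (subst₂ SamePattern (take-map {f = toℕ} p z) (take-map {f = toℕ} p ρ) (SamePattern-take p same)))
      (compatible-cong (drop p z) (drop p ρ) (labels r₂) (trans (length-drop-p z len-z) (sym (length-labels r₂)))
        (subst₂ SamePattern (drop-map {f = toℕ} p z) (drop-map {f = toℕ} p ρ) (SamePattern-drop p same)))
      where
      same : SamePattern (labels z) (labels ρ)
      same = hasPattern⇒SamePattern z ρ (trans len-z (sym len-ρ)) z~ρ

    -- u · m_r₁ · m_r₂ = Σ u · m_ρ, over restricted-growth ρ restricting to r₁ and r₂.
    product-expansion : ∀ w →
      ΣW p (λ z₁ → [ hasPattern z₁ r₁ ]· monomialCoeff (u ++ z₁) (labels r₂) w) ≡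
      ΣW (p +ℕ m) (λ ρ → [ isRGS ρ ]· [ Q ρ ]· monomialCoeff u (labels ρ) w)
    product-expansion w = begin
      ΣW p (λ z₁ → [ hasPattern z₁ r₁ ]· monomialCoeff (u ++ z₁) (labels r₂) w)
        ≡⟨ ΣW-cong p (λ z₁ len₁ → trans (cong ([ hasPattern z₁ r₁ ]·_)
                                              (cong (λ l → ΣW l (λ z₂ → [ hasPattern z₂ r₂ ]· δ ((u ++ z₁) ++ z₂) w))
                                                    (length-labels r₂)))
                                        (trans ([]·-Σl (hasPattern z₁ r₁) _ (allWords n m))
                                               (ΣW-cong m (λ z₂ _ → concatenated z₁ z₂ len₁)))) ⟩
      ΣW p (λ z₁ → ΣW m (λ z₂ → [ Q (z₁ ++ z₂) ]· δ (u ++ z₁ ++ z₂) w))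
        ≡⟨ ΣW-split p m (λ z → [ Q z ]· δ (u ++ z) w) ⟨
      ΣW (p +ℕ m) (λ z → [ Q z ]· δ (u ++ z) w)
        ≡⟨ ΣW-byPattern (p +ℕ m) Q (λ z → δ (u ++ z) w) Q-invariant ⟩
      ΣW (p +ℕ m) (λ ρ → [ isRGS ρ ]· [ Q ρ ]· ΣW (p +ℕ m) (λ z → [ hasPattern z ρ ]· δ (u ++ z) w))
        ≡⟨ ΣW-cong (p +ℕ m) (λ ρ len-ρ → cong (λ l → [ isRGS ρ ]· [ Q ρ ]· ΣW l (λ z → [ hasPattern z ρ ]· δ (u ++ z) w))
                                             (sym (trans (length-labels ρ) len-ρ))) ⟩
      ΣW (p +ℕ m) (λ ρ → [ isRGS ρ ]· [ Q ρ ]· monomialCoeff u (labels ρ) w)  ∎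
      where
      open ≡-Reasoning
      concatenated : ∀ (z₁ z₂ : Word n) → length z₁ ≡ p →
        [ hasPattern z₁ r₁ ]· [ hasPattern z₂ r₂ ]· δ ((u ++ z₁) ++ z₂) w ≡ [ Q (z₁ ++ z₂) ]· δ (u ++ z₁ ++ z₂) w
      concatenated z₁ z₂ len₁ = begin
        [ hasPattern z₁ r₁ ]· [ hasPattern z₂ r₂ ]· δ ((u ++ z₁) ++ z₂) w
          ≡⟨ []·-∧ (hasPattern z₁ r₁) (hasPattern z₂ r₂) _ ⟨
        [ hasPattern z₁ r₁ ∧ hasPattern z₂ r₂ ]· δ ((u ++ z₁) ++ z₂) w
          ≡⟨ cong₂ (λ b x → [ b ]· δ x w)
                   (sym (cong₂ (λ a b → hasPattern a r₁ ∧ hasPattern b r₂)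
                               (take-++-length z₁ z₂ len₁) (drop-++-length z₁ z₂ len₁)))
                   (++-assoc u z₁ z₂) ⟩
        [ Q (z₁ ++ z₂) ]· δ (u ++ z₁ ++ z₂) w  ∎

    r : Word n
    r = r₁ ++ r₂

    split-leading : ∀ w → isRGS r ≡ true → Q r ≡ true →
      ΣW (p +ℕ m) (λ ρ → [ isRGS ρ ]· [ Q ρ ]· monomialCoeff u (labels ρ) w) ≡
      monomialCoeff u (labels r) w + ΣW (p +ℕ m) (λ ρ → [ isRGS ρ ]· [ Q ρ ]· [ not ⌊ ρ ≟ʷ r ⌋ ]· monomialCoeff u (labels ρ) w)
    split-leading w rgs-r Q-r = trans (ΣW-cong (p +ℕ m) (λ ρ _ → split ρ))
      (trans (Σl-+ _ _ (allWords n (p +ℕ m)))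
             (cong (_+ ΣW (p +ℕ m) (λ ρ → [ isRGS ρ ]· [ Q ρ ]· [ not ⌊ ρ ≟ʷ r ⌋ ]· monomialCoeff u (labels ρ) w))
                   (ΣW-indicator (λ ρ → monomialCoeff u (labels ρ) w) r (length-++ r₁))))
      where
      split : ∀ (ρ : Word n) → [ isRGS ρ ]· [ Q ρ ]· monomialCoeff u (labels ρ) w ≡
                    [ ⌊ ρ ≟ʷ r ⌋ ]· monomialCoeff u (labels ρ) w +
                    [ isRGS ρ ]· [ Q ρ ]· [ not ⌊ ρ ≟ʷ r ⌋ ]· monomialCoeff u (labels ρ) w
      split ρ with ρ ≟ʷ r
      ... | yes refl rewrite rgs-r | Q-r = sym (ℚP.+-identityʳ _)
      ... | no  _    = sym (ℚP.+-identityˡ _)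

    prefix-determined : IsSetPartition (labels r) →
                        ∀ (ρ : Word n) → length ρ ≡ p +ℕ m → isRGS ρ ≡ true → Q ρ ≡ true → take p ρ ≡ r₁
    prefix-determined rgs-r ρ len-ρ rgs-ρ Q-ρ = labels-injective (rgs-unique
      (subst IsSetPartition (take-map {f = toℕ} p ρ)
             (IsRGSFrom-++⁻ˡ 0 (take p (labels ρ))
                (subst IsSetPartition (sym (take++drop≡id p (labels ρ))) (isSetPartitionᵇ-sound _ rgs-ρ))))
      (IsRGSFrom-++⁻ˡ 0 (labels r₁) (subst IsSetPartition (labels-++ r₁ r₂) rgs-r))
      (hasPattern⇒SamePattern (take p ρ) r₁ (length-take-p ρ len-ρ) (∧-conicalˡ _ _ Q-ρ)))

    leading-code : IsSetPartition (labels r) → IsSetPartition (labels r₂) →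
                   ∀ (ρ : Word n) → length ρ ≡ p +ℕ m → isRGS ρ ≡ true → Q ρ ≡ true → ρ ≢ r → code r < code ρ
    leading-code rgs-r rgs-r₂ ρ len-ρ rgs-ρ Q-ρ ρ≢r
      with rgs-lexLeast rgs-r₂ (hasPattern⇒SamePattern (drop p ρ) r₂ (length-drop-p ρ len-ρ) (∧-conicalʳ _ _ Q-ρ))
    ... | inj₁ r₂≡ = ⊥-elim (ρ≢r (trans (sym (take++drop≡id p ρ))
                                        (cong₂ _++_ (prefix-determined rgs-r ρ len-ρ rgs-ρ Q-ρ) (labels-injective (sym r₂≡)))))
    ... | inj₂ lt  = <ₗₑₓ⇒code< r ρ (trans (length-++ r₁) (sym len-ρ))
                       (subst₂ _<ₗₑₓ_ (sym (labels-++ r₁ r₂))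
                                      (trans (cong (λ z → labels z ++ labels (drop p ρ)) (sym (prefix-determined rgs-r ρ len-ρ rgs-ρ Q-ρ)))
                                             (trans (sym (labels-++ (take p ρ) (drop p ρ))) (cong labels (take++drop≡id p ρ))))
                                      (<ₗₑₓ-++ (labels r₁) lt))

  InSpan-nonsplitable : ∀ u r → rgsTail (labels r) ≡ length r → 1 ≤ length r → InSpan (monomialCoeff u (labels r))
  InSpan-nonsplitable u r full nonempty with length u +ℕ length r ℕ.≟ k
  ... | no  len≢ = InSpan-zero (λ w len → monomialCoeff-length u (labels r) w
                     (λ eq → len≢ (trans (cong (length u +ℕ_) (sym (length-labels r))) (trans (sym eq) len))))
  ... | yes len≡ = let prefix≡ , suffix≡ , nonstd = rgsSplit-++ u r full nonempty in
    InSpan-cong (λ w _ → cong₂ (λ v s → monomialCoeff v (labels s) w) prefix≡ suffix≡)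
                (InSpan-generator (u ++ r) (trans (length-++ u) len≡) nonstd)

  private
    x≡y+z⇒y≡x-z : ∀ x y z → x ≡ y + z → y ≡ x - z
    x≡y+z⇒y≡x-z x y z x≡y+z = sym (begin
      x - z            ≡⟨ cong (_- z) x≡y+z ⟩
      (y + z) - z      ≡⟨ ℚP.+-assoc y z (- z) ⟩
      y + (z - z)      ≡⟨ cong (y +_) (ℚP.+-inverseʳ z) ⟩
      y + 0ℚ           ≡⟨ ℚP.+-identityʳ y ⟩
      y                ∎)
      where open ≡-Reasoning

  InSpan-product : ∀ u r₁ r₂ → IsSetPartition (labels (r₁ ++ r₂)) → IsSetPartition (labels r₂) →
                   (∀ v → InSpan (monomialCoeff v (labels r₂))) →
                   (∀ ρ → length ρ ≡ length (r₁ ++ r₂) → code (r₁ ++ r₂) < code ρ → IsSetPartition (labels ρ) →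
                          InSpan (monomialCoeff u (labels ρ))) →
                   InSpan (monomialCoeff u (labels (r₁ ++ r₂)))
  InSpan-product u r₁ r₂ rgs-r rgs-r₂ tail∈ higher∈ = InSpan-cong (λ w _ → sym (expansion w)) (InSpan-sub product∈ higher-terms∈)
    where
    open Product u r₁ r₂
    product∈ : InSpan (λ w → ΣW p (λ z₁ → [ hasPattern z₁ r₁ ]· monomialCoeff (u ++ z₁) (labels r₂) w))
    product∈ = InSpan-ΣW p _ (λ z₁ _ → InSpan-[]· (hasPattern z₁ r₁) (tail∈ (u ++ z₁)))
    higher-term∈ : ∀ ρ → length ρ ≡ p +ℕ m →
                   InSpan (λ w → [ isRGS ρ ]· [ Q ρ ]· [ not ⌊ ρ ≟ʷ r ⌋ ]· monomialCoeff u (labels ρ) w)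
    higher-term∈ ρ len-ρ with isRGS ρ in rgs-ρ | Q ρ in Q-ρ | ρ ≟ʷ r
    ... | true  | true  | no ρ≢r = higher∈ ρ (trans len-ρ (sym (length-++ r₁)))
                                     (leading-code rgs-r rgs-r₂ ρ len-ρ rgs-ρ Q-ρ ρ≢r) (isSetPartitionᵇ-sound _ rgs-ρ)
    ... | true  | true  | yes _  = InSpan-zero (λ _ _ → refl)
    ... | true  | false | _      = InSpan-zero (λ _ _ → refl)
    ... | false | _     | _      = InSpan-zero (λ _ _ → refl)
    higher-terms∈ : InSpan (λ w → ΣW (p +ℕ m) (λ ρ →
                      [ isRGS ρ ]· [ Q ρ ]· [ not ⌊ ρ ≟ʷ r ⌋ ]· monomialCoeff u (labels ρ) w))
    higher-terms∈ = InSpan-ΣW (p +ℕ m) _ higher-term∈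
    Q-r : Q r ≡ true
    Q-r = cong₂ _∧_ (trans (cong (λ z → hasPattern z r₁) (take-++-length r₁ r₂ refl)) (hasPattern-refl r₁))
                    (trans (cong (λ z → hasPattern z r₂) (drop-++-length r₁ r₂ refl)) (hasPattern-refl r₂))
    expansion : ∀ w → monomialCoeff u (labels r) w ≡
                      ΣW p (λ z₁ → [ hasPattern z₁ r₁ ]· monomialCoeff (u ++ z₁) (labels r₂) w) -
                      ΣW (p +ℕ m) (λ ρ → [ isRGS ρ ]· [ Q ρ ]· [ not ⌊ ρ ≟ʷ r ⌋ ]· monomialCoeff u (labels ρ) w)
    expansion w = x≡y+z⇒y≡x-z _ _ _
      (trans (product-expansion w) (split-leading w (isSetPartitionᵇ-complete rgs-r) Q-r))

  InSpan-rgsMonomial-step :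
    ∀ r → IsSetPartition (labels r) → 1 ≤ length r →
    (∀ r′ → length r′ < length r → IsSetPartition (labels r′) → 1 ≤ length r′ →
            ∀ v → InSpan (monomialCoeff v (labels r′))) →
    (∀ u ρ → length ρ ≡ length r → code r < code ρ → IsSetPartition (labels ρ) → InSpan (monomialCoeff u (labels ρ))) →
    ∀ u → InSpan (monomialCoeff u (labels r))
  InSpan-rgsMonomial-step r rgs nonempty shorter∈ higher∈ u with rgsTail (labels r) ℕ.≟ length r
  ... | yes full = InSpan-nonsplitable u r full nonempty
  ... | no ¬full with rgsTail-suffix (labels r) (tailLength-setPartition r nonempty rgs)
  ...   | us , as , labels≡ , len-as , rgs-as =
    subst (λ z → InSpan (monomialCoeff u (labels z))) (take++drop≡id p r)
      (InSpan-product u r₁ r₂ (subst (IsSetPartition ∘ labels) (sym (take++drop≡id p r)) rgs) rgs-r₂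
        (shorter∈ r₂ r₂<r rgs-r₂
          (subst (1 ≤_) (sym len-r₂) (ℕP.≤∧≢⇒< z≤n (λ 0≡m → tailLength-setPartition r nonempty rgs (sym 0≡m)))))
        (λ ρ len lt → higher∈ u ρ (trans len (cong length (take++drop≡id p r)))
                                  (subst (λ z → code z < code ρ) (take++drop≡id p r) lt)))
    where
    p : ℕ
    p = length us
    r₁ r₂ : Word n
    r₁ = take p r
    r₂ = drop p r
    labels-r₂ : labels r₂ ≡ as
    labels-r₂ = trans (sym (drop-map p r)) (trans (cong (drop p) labels≡) (drop-++-length us as refl))
    rgs-r₂ : IsSetPartition (labels r₂)
    rgs-r₂ = subst IsSetPartition (sym labels-r₂) rgs-as
    len-r₂ : length r₂ ≡ rgsTail (labels r)
    len-r₂ = trans (sym (length-labels r₂)) (trans (cong length labels-r₂) len-as)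
    r₂<r : length r₂ < length r
    r₂<r = subst (_< length r) (sym len-r₂)
             (ℕP.≤∧≢⇒< (subst (rgsTail (labels r) ≤_) (length-labels r) (rgsTail-≤ (labels r))) ¬full)

  InSpan-rgsMonomial : ∀ r → IsSetPartition (labels r) → 1 ≤ length r → ∀ u → InSpan (monomialCoeff u (labels r))
  InSpan-rgsMonomial r = <-rec P (λ j shorter∈ → code-rec-downward j _ (λ r len higher∈ rgs nonempty →
      InSpan-rgsMonomial-step r rgs nonempty
        (λ r′ r′<r → shorter∈ (subst (length r′ <_) len r′<r) r′ refl)
        (λ u ρ len-ρ r<ρ rgs-ρ → higher∈ ρ (trans len-ρ len) r<ρ rgs-ρ (subst (1 ≤_) (sym len-ρ) nonempty) u)))
    (length r) r refl
    where
    P : ℕ → Set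
    P j = ∀ r → length r ≡ j → IsSetPartition (labels r) → 1 ≤ length r → ∀ u → InSpan (monomialCoeff u (labels r))

  InSpan-monomial : ∀ u A → 1 ≤ length A → InSpan (monomialCoeff u A)
  InSpan-monomial u A nonempty = InSpan-cong (λ w _ → sym (grouped w)) (InSpan-ΣW (length A) _ term∈)
    where
    compatible-invariant : ∀ z ρ → length z ≡ length A → length ρ ≡ length A → hasPattern z ρ ≡ true →
                           compatible (zip z A) ≡ compatible (zip ρ A)
    compatible-invariant z ρ len-z len-ρ z~ρ =
      compatible-cong z ρ A len-z (hasPattern⇒SamePattern z ρ (trans len-z (sym len-ρ)) z~ρ)
    grouped : ∀ w → monomialCoeff u A w ≡
                    ΣW (length A) (λ ρ → [ isRGS ρ ]· [ compatible (zip ρ A) ]· monomialCoeff u (labels ρ) w)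
    grouped w = trans (ΣW-byPattern (length A) (λ z → compatible (zip z A)) (λ z → δ (u ++ z) w) compatible-invariant)
      (ΣW-cong (length A) (λ ρ len-ρ → cong (λ l → [ isRGS ρ ]· [ compatible (zip ρ A) ]· ΣW l (λ z → [ hasPattern z ρ ]· δ (u ++ z) w))
                                            (sym (trans (length-labels ρ) len-ρ))))
    term∈ : ∀ ρ → length ρ ≡ length A → InSpan (λ w → [ isRGS ρ ]· [ compatible (zip ρ A) ]· monomialCoeff u (labels ρ) w)
    term∈ ρ len-ρ with isRGS ρ in rgs-ρ
    ... | true  = InSpan-[]· (compatible (zip ρ A))
                    (InSpan-rgsMonomial ρ (isSetPartitionᵇ-sound _ rgs-ρ) (subst (1 ≤_) (sym len-ρ) nonempty) u)
    ... | false = InSpan-zero (λ _ _ → refl)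

  -- u · (s − constant term of s)
  InSpan-generatorTerm : ∀ u (s : NCElt) →
                         InSpan (λ w → prefixCoeff u (toPoly n s) w - coeff (toPoly n s) [] * δ u w)
  InSpan-generatorTerm u [] = InSpan-zero (λ w _ → solve 1 (λ d → con 0ℚ :- con 0ℚ :* d := con 0ℚ) refl (δ u w))
  InSpan-generatorTerm u ((q , (A , A-partition)) ∷ s) =
    InSpan-cong (λ w _ → sym (regroup w)) (InSpan-+ (InSpan-* q (term∈ A)) (InSpan-generatorTerm u s))
    where
    term∈ : ∀ A → InSpan (λ w → monomialCoeff u A w - monomialCoeff [] A [] * δ u w)
    term∈ []      = InSpan-zero (λ w _ → trans (cong₂ (λ x y → x - y * δ u w) (monomialCoeff-[] u w) (monomialCoeff-[] [] []))
                                              (solve 1 (λ d → d :- con 1ℚ :* d := con 0ℚ) refl (δ u w)))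
    term∈ (a ∷ A) = InSpan-cong (λ w _ → sym (trans (cong (λ y → monomialCoeff u (a ∷ A) w - y * δ u w)
                                                         (monomialCoeff-length [] (a ∷ A) [] (λ ())))
                                                   (solve 2 (λ x d → x :- con 0ℚ :* d := x) refl (monomialCoeff u (a ∷ A) w) (δ u w))))
                                (InSpan-monomial u (a ∷ A) (s≤s z≤n))
    P : Word n → ℚ
    P = prefixCoeff u (toPoly n s)
    C : ℚ
    C = coeff (toPoly n s) []
    regroup : ∀ w → prefixCoeff u (toPoly n ((q , (A , A-partition)) ∷ s)) w - coeff (toPoly n ((q , (A , A-partition)) ∷ s)) [] * δ u w ≡
                    q * (monomialCoeff u A w - monomialCoeff [] A [] * δ u w) + (P w - C * δ u w)
    regroup w = begin
      _ ≡⟨ cong₂ (λ x y → x - y * δ u w) (prefix-step u w)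
                 (trans (coeff≡prefixCoeff[] (toPoly n ((q , (A , A-partition)) ∷ s)) []) (prefix-step [] [])) ⟩
      (q * monomialCoeff u A w + P w) - (q * monomialCoeff [] A [] + prefixCoeff [] (toPoly n s) []) * δ u w
        ≡⟨ solve 6 (λ q x y d p c → (q :* x :+ p) :- (q :* y :+ c) :* d := q :* (x :- y :* d) :+ (p :- c :* d))
                 refl q (monomialCoeff u A w) (monomialCoeff [] A []) (δ u w) (P w) (prefixCoeff [] (toPoly n s) []) ⟩
      q * (monomialCoeff u A w - monomialCoeff [] A [] * δ u w) + (P w - prefixCoeff [] (toPoly n s) [] * δ u w)
        ≡⟨ cong (λ c → q * (monomialCoeff u A w - monomialCoeff [] A [] * δ u w) + (P w - c * δ u w)) (coeff≡prefixCoeff[] (toPoly n s) []) ⟨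
      q * (monomialCoeff u A w - monomialCoeff [] A [] * δ u w) + (P w - C * δ u w)  ∎
      where
      open ≡-Reasoning
      prefix-step : ∀ v w → prefixCoeff v (toPoly n ((q , (A , A-partition)) ∷ s)) w ≡ q * monomialCoeff v A w + prefixCoeff v (toPoly n s) w
      prefix-step v w = trans (prefixCoeff-++ v (scale q (monomialNC n A)) (toPoly n s) w)
        (cong (_+ prefixCoeff v (toPoly n s) w) (trans (prefixCoeff-scale v q (monomialNC n A) w)
                                                       (cong (q *_) (prefixCoeff-monomialNC v A w))))

  coeff-foldr : ∀ (F : Poly n × NCElt → Poly n → Poly n) → (∀ f s acc → F (f , s) acc ≡ (f ⊗ toPoly n s) ⊕ acc) →
                ∀ gens w → coeff (foldr F [] gens) w ≡ Σl (λ g → coeff (proj₁ g ⊗ toPoly n (proj₂ g)) w) gens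
  coeff-foldr F F≡ []              w = refl
  coeff-foldr F F≡ ((f , s) ∷ gens) w = trans (cong (λ p → coeff p w) (F≡ f s _))
    (trans (coeff-++ (f ⊗ toPoly n s) _ w) (cong (coeff (f ⊗ toPoly n s) w +_) (coeff-foldr F F≡ gens w)))

  InSpan-idealGenerator : ∀ f s → coeff (toPoly n s) [] ≡ 0ℚ → InSpan (coeff (f ⊗ toPoly n s))
  InSpan-idealGenerator f s no-constant = InSpan-cong (λ w _ → sym (coeff-⊗ f (toPoly n s) w))
    (InSpan-Σl _ (All.universal (λ _ → tt) f) λ (c , u) _ → InSpan-* c
      (InSpan-cong (λ w _ → trans (cong (λ c₀ → prefixCoeff u (toPoly n s) w - c₀ * δ u w) no-constant)
                                  (solve 2 (λ x d → x :- con 0ℚ :* d := x) refl (prefixCoeff u (toPoly n s) w) (δ u w)))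
                   (InSpan-generatorTerm u s)))

  InIdeal⇒InSpan : ∀ p → InIdeal n p → InSpan (coeff p)
  InIdeal⇒InSpan p (gens , no-constants , p≡) =
    InSpan-cong (λ w _ → sym (trans (p≡ w) (coeff-foldr _ (λ _ _ _ → refl) gens w)))
                (InSpan-Σl (λ g w → coeff (proj₁ g ⊗ toPoly n (proj₂ g)) w) no-constants
                           (λ (f , s) no-constant → InSpan-idealGenerator f s no-constant))

  rgsSuffixPartition : Word n → SetPartition
  rgsSuffixPartition x with isRGSFrom? 0 (labels (rgsSuffix x))
  ... | yes rgs = labels (rgsSuffix x) , rgs
  ... | no  _   = [] , tt

  rgsSuffixPartition-labels : ∀ x → isStandard x ≡ false → proj₁ (rgsSuffixPartition x) ≡ labels (rgsSuffix x)
  rgsSuffixPartition-labels x nonstd with isRGSFrom? 0 (labels (rgsSuffix x))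
  ... | yes _    = refl
  ... | no  ¬rgs = ⊥-elim (¬rgs (proj₁ (rgsSuffix-spec x nonstd)))

  rgsSuffix-nonempty : ∀ x → isStandard x ≡ false → 1 ≤ length (labels (rgsSuffix x))
  rgsSuffix-nonempty x nonstd =
    subst (1 ≤_) (sym (trans (length-labels (rgsSuffix x)) (proj₂ (rgsSuffix-spec x nonstd))))
          (ℕP.n≢0⇒n>0 (nonstandard⇒tailLength≢0 x nonstd))

  generator-length : ∀ x w → length x ≡ k → length w ≢ k → generator x w ≡ 0ℚ
  generator-length x w len-x len-w = monomialCoeff-length (rgsPrefix x) (labels (rgsSuffix x)) w λ len → len-w (begin
    length w                                                     ≡⟨ len ⟩
    length (rgsPrefix x) +ℕ length (labels (rgsSuffix x))        ≡⟨ cong (length (rgsPrefix x) +ℕ_) (length-labels (rgsSuffix x)) ⟩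
    length (rgsPrefix x) +ℕ length (rgsSuffix x)                 ≡⟨ length-++ (rgsPrefix x) ⟨
    length (rgsPrefix x ++ rgsSuffix x)                          ≡⟨ cong length (rgsPrefix++rgsSuffix x) ⟩
    length x                                                     ≡⟨ len-x ⟩
    k                                                            ∎)
    where open ≡-Reasoning

  suffixElement : Word n → NCElt
  suffixElement x = (1ℚ , rgsSuffixPartition x) ∷ []

  prefixCoeff-suffixElement : ∀ x v w → isStandard x ≡ false →
                              prefixCoeff v (toPoly n (suffixElement x)) w ≡ monomialCoeff v (labels (rgsSuffix x)) w
  prefixCoeff-suffixElement x v w nonstd = begin
    prefixCoeff v (scale 1ℚ (monomialNC n A) ++ []) w    ≡⟨ prefixCoeff-++ v (scale 1ℚ (monomialNC n A)) [] w ⟩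
    prefixCoeff v (scale 1ℚ (monomialNC n A)) w + 0ℚ     ≡⟨ ℚP.+-identityʳ _ ⟩
    prefixCoeff v (scale 1ℚ (monomialNC n A)) w          ≡⟨ prefixCoeff-scale v 1ℚ (monomialNC n A) w ⟩
    1ℚ * prefixCoeff v (monomialNC n A) w                ≡⟨ ℚP.*-identityˡ _ ⟩
    prefixCoeff v (monomialNC n A) w                     ≡⟨ prefixCoeff-monomialNC v A w ⟩
    monomialCoeff v A w                                  ≡⟨ cong (λ B → monomialCoeff v B w) (rgsSuffixPartition-labels x nonstd) ⟩
    monomialCoeff v (labels (rgsSuffix x)) w             ∎
    where
    open ≡-Reasoning
    A : List ℕ
    A = proj₁ (rgsSuffixPartition x)

  suffixElement-noConstant : ∀ x → isStandard x ≡ false → coeff (toPoly n (suffixElement x)) [] ≡ 0ℚ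
  suffixElement-noConstant x nonstd =
    trans (coeff≡prefixCoeff[] (toPoly n (suffixElement x)) [])
      (trans (prefixCoeff-suffixElement x [] [] nonstd)
             (monomialCoeff-length [] (labels (rgsSuffix x)) [] (λ 0≡len → ℕP.<⇒≢ (rgsSuffix-nonempty x nonstd) 0≡len)))

  coeff-generatorElement : ∀ c x w → isStandard x ≡ false →
                           coeff (((c , rgsPrefix x) ∷ []) ⊗ toPoly n (suffixElement x)) w ≡ c * generator x w
  coeff-generatorElement c x w nonstd = begin
    coeff (((c , rgsPrefix x) ∷ []) ⊗ toPoly n (suffixElement x)) w
      ≡⟨ coeff-⊗ ((c , rgsPrefix x) ∷ []) (toPoly n (suffixElement x)) w ⟩
    c * prefixCoeff (rgsPrefix x) (toPoly n (suffixElement x)) w + 0ℚ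
      ≡⟨ ℚP.+-identityʳ _ ⟩
    c * prefixCoeff (rgsPrefix x) (toPoly n (suffixElement x)) w
      ≡⟨ cong (c *_) (prefixCoeff-suffixElement x (rgsPrefix x) w nonstd) ⟩
    c * generator x w  ∎
    where open ≡-Reasoning

  combination-length : ∀ a w → length w ≢ k → combination a w ≡ 0ℚ
  combination-length a w len≢ = trans (ΣW-cong k vanish) (Σl-zero (allWords n k))
    where
    vanish : ∀ x → length x ≡ k → [ not (isStandard x) ]· (a x * generator x w) ≡ 0ℚ
    vanish x len-x = trans (cong (λ g → [ not (isStandard x) ]· (a x * g)) (generator-length x w len-x len≢))
                           (trans (cong ([ not (isStandard x) ]·_) (ℚP.*-zeroʳ (a x))) ([]·-0 _))

  InSpan⇒InIdeal : ∀ p → Homog k p → InSpan (coeff p) → InIdeal n p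
  InSpan⇒InIdeal p homog (a , p≡) =
    gens , All-map-filterB _ idealGenerator (allWords n k) no-constant ,
    λ w → trans (coeff≡combination w) (sym (trans (coeff-foldr _ (λ _ _ _ → refl) gens w) (sum≡combination w)))
    where
    idealGenerator : Word n → Poly n × NCElt
    idealGenerator x = ((a x , rgsPrefix x) ∷ []) , suffixElement x
    gens : List (Poly n × NCElt)
    gens = map idealGenerator (filterB (not ∘ isStandard) (allWords n k))
    no-constant : ∀ x → not (isStandard x) ≡ true → coeff (toPoly n (suffixElement x)) [] ≡ 0ℚ
    no-constant x ns = suffixElement-noConstant x (trans (sym (not-involutive (isStandard x))) (cong not ns))
    sum≡combination : ∀ w → Σl (λ g → coeff (proj₁ g ⊗ toPoly n (proj₂ g)) w) gens ≡ combination a w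
    sum≡combination w = trans (Σl-map _ idealGenerator (filterB (not ∘ isStandard) (allWords n k)))
      (trans (Σl-filterB (not ∘ isStandard) _ (allWords n k)) (ΣW-cong k (λ x _ → on-nonstandard x)))
      where
      on-nonstandard : ∀ x → [ not (isStandard x) ]· coeff (((a x , rgsPrefix x) ∷ []) ⊗ toPoly n (suffixElement x)) w ≡
                             [ not (isStandard x) ]· (a x * generator x w)
      on-nonstandard x with isStandard x in std
      ... | true  = refl
      ... | false = coeff-generatorElement (a x) x w std
    coeff≡combination : ∀ w → coeff p w ≡ combination a w
    coeff≡combination w with length w ℕ.≟ k
    ... | yes len  = p≡ w len
    ... | no  len≢ = trans (homog w len≢) (sym (combination-length a w len≢))

module Reduction (n k : ℕ) where

  open import Data.Nat as ℕ using (_<_)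
  open import Data.Bool.Properties using (∧-conicalˡ; ∧-conicalʳ; ∧-identityʳ)
  open import Data.Bool using (Bool; true; false; not; _∧_)
  open import Data.List using (List; _++_; length)
  open import Data.Rational using (ℚ; 0ℚ; 1ℚ; _+_; _*_; -_; _-_)
  open import Data.Product using (Σ-syntax; _,_; proj₁; proj₂)
  open import Data.Sum using (inj₁; inj₂)
  open import Data.Empty using (⊥-elim)
  open import Function using (case_of_)
  open import Relation.Nullary using (yes; no; ⌊_⌋)
  open import Relation.Binary.PropositionalEquality
  open import Defs
  open import Data.Rational.Solver using (module +-*-Solver)
  open +-*-Solver using (solve; _:=_; _:+_; _:*_; _:-_; :-_; con)
  open Patterns
  open Words n
  open Coefficients n
  open Span n k
  open IdealIsSpan n k using (hasPattern; hasPattern-refl)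

  standardCombination : (Word n → ℚ) → Word n → ℚ
  standardCombination b w = ΣW k (λ t → [ isStandard t ]· (b t * δ t w))

  standardCombination-Σl : ∀ {X : Set} (xs : List X) (a : X → ℚ) (b : X → Word n → ℚ) w →
    standardCombination (λ t → Σl (λ e → a e * b e t) xs) w ≡ Σl (λ e → a e * standardCombination (b e) w) xs
  standardCombination-Σl xs a b w = begin
    ΣW k (λ t → [ isStandard t ]· (Σl (λ e → a e * b e t) xs * δ t w))
      ≡⟨ ΣW-cong k (λ t _ → distribute t) ⟩
    ΣW k (λ t → Σl (λ e → a e * [ isStandard t ]· (b e t * δ t w)) xs)
      ≡⟨ Σl-swap (λ t e → a e * [ isStandard t ]· (b e t * δ t w)) (allWords n k) xs ⟩
    Σl (λ e → ΣW k (λ t → a e * [ isStandard t ]· (b e t * δ t w))) xs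
      ≡⟨ Σl-cong (λ e → Σl-*ˡ (a e) (λ t → [ isStandard t ]· (b e t * δ t w)) (allWords n k)) xs ⟩
    Σl (λ e → a e * standardCombination (b e) w) xs  ∎
    where
    open ≡-Reasoning
    distribute : ∀ t → [ isStandard t ]· (Σl (λ e → a e * b e t) xs * δ t w) ≡ Σl (λ e → a e * [ isStandard t ]· (b e t * δ t w)) xs
    distribute t = begin
      [ isStandard t ]· (Σl (λ e → a e * b e t) xs * δ t w)
        ≡⟨ cong ([ isStandard t ]·_) (trans (ℚP.*-comm _ (δ t w)) (sym (Σl-*ˡ (δ t w) _ xs))) ⟩
      [ isStandard t ]· Σl (λ e → δ t w * (a e * b e t)) xs
        ≡⟨ []·-Σl (isStandard t) _ xs ⟩
      Σl (λ e → [ isStandard t ]· (δ t w * (a e * b e t))) xs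
        ≡⟨ Σl-cong (λ e → trans (cong ([ isStandard t ]·_)
                                      (solve 3 (λ d x y → d :* (x :* y) := x :* (y :* d)) refl (δ t w) (a e) (b e t)))
                                ([]·-*ʳ (isStandard t) (a e) _)) xs ⟩
      Σl (λ e → a e * [ isStandard t ]· (b e t * δ t w)) xs  ∎

  ReducesToStandard : Word n → Set
  ReducesToStandard x = Σ[ b ∈ (Word n → ℚ) ] InSpan (λ w → δ x w - standardCombination b w)

  reduces-wrongLength : ∀ x → length x ≢ k → ReducesToStandard x
  reduces-wrongLength x len≢ = (λ _ → 0ℚ) , InSpan-zero λ w len → begin
    δ x w - standardCombination (λ _ → 0ℚ) w
      ≡⟨ cong₂ _-_ (δ-≢ {x} {w} (λ { refl → len≢ len }))
                   (trans (ΣW-cong k (λ t _ → trans (cong ([ isStandard t ]·_) (ℚP.*-zeroˡ (δ t w))) ([]·-0 _)))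
                                                        (Σl-zero (allWords n k))) ⟩
    0ℚ - 0ℚ  ≡⟨⟩
    0ℚ       ∎
    where open ≡-Reasoning

  reduces-standard : ∀ x → length x ≡ k → isStandard x ≡ true → ReducesToStandard x
  reduces-standard x len std = (λ t → δ t x) , InSpan-zero λ w _ → begin
    δ x w - ΣW k (λ t → [ isStandard t ]· (δ t x * δ t w))
      ≡⟨ cong (λ y → δ x w - y) (ΣW-cong k (λ t _ → trans (cong ([ isStandard t ]·_) (δ-* t x (δ t w)))
                                                   ([]·-comm (isStandard t) ⌊ t ≟ʷ x ⌋ (δ t w)))) ⟩
    δ x w - ΣW k (λ t → [ ⌊ t ≟ʷ x ⌋ ]· [ isStandard t ]· δ t w)
      ≡⟨ cong (λ y → δ x w - y) (trans (ΣW-indicator (λ t → [ isStandard t ]· δ t w) x len) (cong ([_]· δ x w) std)) ⟩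
    δ x w - δ x w
      ≡⟨ ℚP.+-inverseʳ (δ x w) ⟩
    0ℚ  ∎
    where open ≡-Reasoning

  otherPattern : Word n → Word n → Bool
  otherPattern s z = hasPattern z s ∧ not ⌊ z ≟ʷ s ⌋

  generator-expansion : ∀ x w → isStandard x ≡ false →
    generator x w ≡ δ x w + ΣW (length (rgsSuffix x)) (λ z → [ otherPattern (rgsSuffix x) z ]· δ (rgsPrefix x ++ z) w)
  generator-expansion x w nonstd = begin
    ΣW (length (labels s)) (λ z → [ hasPattern z s ]· δ (u ++ z) w)
      ≡⟨ cong (λ l → ΣW l (λ z → [ hasPattern z s ]· δ (u ++ z) w)) (length-labels s) ⟩
    ΣW (length s) (λ z → [ hasPattern z s ]· δ (u ++ z) w)
      ≡⟨ ΣW-cong (length s) (λ z _ → split z) ⟩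
    ΣW (length s) (λ z → [ ⌊ z ≟ʷ s ⌋ ]· δ (u ++ z) w + [ otherPattern s z ]· δ (u ++ z) w)
      ≡⟨ Σl-+ _ _ (allWords n (length s)) ⟩
    ΣW (length s) (λ z → [ ⌊ z ≟ʷ s ⌋ ]· δ (u ++ z) w) + ΣW (length s) (λ z → [ otherPattern s z ]· δ (u ++ z) w)
      ≡⟨ cong (_+ ΣW (length s) (λ z → [ otherPattern s z ]· δ (u ++ z) w))
              (trans (ΣW-indicator (λ z → δ (u ++ z) w) s refl) (cong (λ v → δ v w) (rgsPrefix++rgsSuffix x))) ⟩
    δ x w + ΣW (length s) (λ z → [ otherPattern s z ]· δ (u ++ z) w)  ∎
    where
    open ≡-Reasoning
    u s : Word n
    u = rgsPrefix x
    s = rgsSuffix x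
    split : ∀ z → [ hasPattern z s ]· δ (u ++ z) w ≡ [ ⌊ z ≟ʷ s ⌋ ]· δ (u ++ z) w + [ otherPattern s z ]· δ (u ++ z) w
    split z with z ≟ʷ s
    ... | yes refl rewrite hasPattern-refl z = sym (ℚP.+-identityʳ _)
    ... | no  _    = sym (trans (ℚP.+-identityˡ _) (cong ([_]· δ (u ++ z) w) (∧-identityʳ (hasPattern z s))))

  otherPattern⇒≢ : ∀ s z → otherPattern s z ≡ true → z ≢ s
  otherPattern⇒≢ s z other z≡s with z ≟ʷ s
  ... | yes _   = case ∧-conicalʳ (hasPattern z s) false other of λ ()
  ... | no  z≢s = z≢s z≡s

  otherPattern-code< : ∀ x z → length x ≡ k → isStandard x ≡ false → otherPattern (rgsSuffix x) z ≡ true →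
                       length (rgsPrefix x ++ z) ≡ k → code x < code (rgsPrefix x ++ z)
  otherPattern-code< x z len nonstd other len′
    with suffix-lexLeast x z nonstd (rgsPrefix-++-length x z (trans len′ (sym len))) (∧-conicalˡ _ _ other)
  ... | inj₁ z≡s  = ⊥-elim (otherPattern⇒≢ (rgsSuffix x) z other z≡s)
  ... | inj₂ x<uz = x<uz

  private
    []·-difference : ∀ c d t → [ c ]· (d - t) ≡ [ c ]· d + [ c ]· (- 1ℚ) * t
    []·-difference true  d t = solve 2 (λ d t → d :- t := d :+ (:- con 1ℚ) :* t) refl d t
    []·-difference false d t = sym (trans (ℚP.+-identityˡ _) (ℚP.*-zeroˡ t))

  reduces-nonstandard : ∀ x → length x ≡ k → isStandard x ≡ false →
                        (∀ y → length y ≡ k → code x < code y → ReducesToStandard y) → ReducesToStandard x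
  reduces-nonstandard x len nonstd higher =
    b , InSpan-cong (λ w _ → sym (rearrange w)) (InSpan-sub (InSpan-generator x len nonstd) others∈)
    where
    u s : Word n
    u = rgsPrefix x
    s = rgsSuffix x
    other : ∀ z → Σ[ b ∈ (Word n → ℚ) ] InSpan (λ w → [ otherPattern s z ]· (δ (u ++ z) w - standardCombination b w))
    other z with otherPattern s z in other-z | length (u ++ z) ℕ.≟ k
    ... | false | _        = (λ _ → 0ℚ) , InSpan-zero (λ _ _ → refl)
    ... | true  | no len≢  = reduces-wrongLength (u ++ z) len≢
    ... | true  | yes len′ = higher (u ++ z) len′ (otherPattern-code< x z len nonstd other-z len′)
    others∈ : InSpan (λ w → ΣW (length s) (λ z → [ otherPattern s z ]· (δ (u ++ z) w - standardCombination (proj₁ (other z)) w)))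
    others∈ = InSpan-ΣW (length s) _ (λ z _ → proj₂ (other z))
    b : Word n → ℚ
    b t = ΣW (length s) (λ z → [ otherPattern s z ]· (- 1ℚ) * proj₁ (other z) t)
    D T : Word n → ℚ
    D w = ΣW (length s) (λ z → [ otherPattern s z ]· δ (u ++ z) w)
    T w = ΣW (length s) (λ z → [ otherPattern s z ]· (- 1ℚ) * standardCombination (proj₁ (other z)) w)
    rearrange : ∀ w → δ x w - standardCombination b w ≡
                      generator x w - ΣW (length s) (λ z → [ otherPattern s z ]· (δ (u ++ z) w - standardCombination (proj₁ (other z)) w))
    rearrange w = begin
      δ x w - standardCombination b w
        ≡⟨ cong (λ y → δ x w - y) (standardCombination-Σl (allWords n (length s)) (λ z → [ otherPattern s z ]· (- 1ℚ))
                                                          (λ z → proj₁ (other z)) w) ⟩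
      δ x w - T w
        ≡⟨ solve 3 (λ d e t → d :- t := (d :+ e) :- (e :+ t)) refl (δ x w) (D w) (T w) ⟩
      (δ x w + D w) - (D w + T w)
        ≡⟨ cong₂ _-_ (generator-expansion x w nonstd)
                     (trans (ΣW-cong (length s) (λ z _ → []·-difference (otherPattern s z) _ _)) (Σl-+ _ _ (allWords n (length s)))) ⟨
      generator x w - ΣW (length s) (λ z → [ otherPattern s z ]· (δ (u ++ z) w - standardCombination (proj₁ (other z)) w))  ∎
      where open ≡-Reasoning

  reduces : ∀ x → ReducesToStandard x
  reduces x with length x ℕ.≟ k
  ... | no  len≢ = reduces-wrongLength x len≢
  ... | yes len  = code-rec-downward k ReducesToStandard step x len
    where
    step : ∀ x → length x ≡ k → (∀ y → length y ≡ k → code x < code y → ReducesToStandard y) → ReducesToStandard x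
    step x len higher with isStandard x in std
    ... | true  = reduces-standard x len std
    ... | false = reduces-nonstandard x len std higher

module LinearDependence where

  open import Data.Nat using (zero; suc)
  open import Data.Fin as Fin using (Fin; punchIn; punchOut)
  import Data.Fin.Properties as FinP
  open import Data.Rational using (ℚ; 0ℚ; 1ℚ; _+_; _*_; -_; _-_; 1/_; NonZero; ≢-nonZero)
  open import Data.Rational.Solver using (module +-*-Solver)
  open +-*-Solver using (solve; _:=_; _:+_; _:*_; _:-_; :-_; con)
  open import Data.Product using (Σ-syntax; _×_; _,_)
  open import Data.Empty using (⊥-elim)
  open import Function using (_∘_)
  open import Relation.Nullary using (yes; no; ¬?)
  open import Relation.Binary.PropositionalEquality
  open ℚSums

  ΣF-punchIn : ∀ m (p : Fin (suc m)) (f : Fin (suc m) → ℚ) → ΣF (suc m) f ≡ f p + ΣF m (f ∘ punchIn p)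
  ΣF-punchIn m       Fin.zero    f = refl
  ΣF-punchIn (suc m) (Fin.suc p) f = trans (cong (f Fin.zero +_) (ΣF-punchIn m p (f ∘ Fin.suc)))
    (solve 3 (λ a b c → a :+ (b :+ c) := b :+ (a :+ c)) refl (f Fin.zero) (f (Fin.suc p)) (ΣF m (f ∘ Fin.suc ∘ punchIn p)))

  ΣF-neg : ∀ m (f : Fin m → ℚ) → ΣF m (λ i → - f i) ≡ - ΣF m f
  ΣF-neg zero    f = refl
  ΣF-neg (suc m) f = trans (cong (- f Fin.zero +_) (ΣF-neg m (f ∘ Fin.suc))) (sym (ℚP.neg-distrib-+ (f Fin.zero) _))

  NontrivialRelation : ∀ r d → (Fin r → Fin d → ℚ) → Set
  NontrivialRelation r d M =
    Σ[ c ∈ (Fin r → ℚ) ] (Σ[ i ∈ Fin r ] c i ≢ 0ℚ) × (∀ j → ΣF r (λ i → c i * M i j) ≡ 0ℚ)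

  relation-zeroColumn : ∀ d (M : Fin (suc (suc d)) → Fin (suc d) → ℚ) → (∀ p → M p Fin.zero ≡ 0ℚ) →
                        NontrivialRelation (suc d) d (λ i j → M (Fin.suc i) (Fin.suc j)) →
                        NontrivialRelation (suc (suc d)) (suc d) M
  relation-zeroColumn d M column₀≡0 (c′ , (i , c′ᵢ≢0) , c′-rel) = c , (Fin.suc i , c′ᵢ≢0) , c-rel
    where
    c : Fin (suc (suc d)) → ℚ
    c Fin.zero    = 0ℚ
    c (Fin.suc i) = c′ i
    c-rel : ∀ j → ΣF (suc (suc d)) (λ i → c i * M i j) ≡ 0ℚ
    c-rel Fin.zero    = trans (cong₂ _+_ (ℚP.*-zeroˡ (M Fin.zero Fin.zero))
                                         (trans (ΣF-cong (suc d) (λ i → trans (cong (c′ i *_) (column₀≡0 (Fin.suc i))) (ℚP.*-zeroʳ (c′ i))))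
                                                (ΣF-zero (suc d))))
                              (ℚP.+-identityˡ 0ℚ)
    c-rel (Fin.suc j) = trans (cong₂ _+_ (ℚP.*-zeroˡ (M Fin.zero (Fin.suc j))) (c′-rel j)) (ℚP.+-identityˡ 0ℚ)

  module PivotElimination {d} (M : Fin (suc (suc d)) → Fin (suc d) → ℚ) (p : Fin (suc (suc d)))
                          (pivot≢0 : M p Fin.zero ≢ 0ℚ) where

    instance
      pivot-nonZero : NonZero (M p Fin.zero)
      pivot-nonZero = ≢-nonZero pivot≢0

    pivot : ℚ
    pivot = M p Fin.zero

    α : Fin (suc d) → ℚ
    α i = M (punchIn p i) Fin.zero * 1/ pivot

    α-pivot : ∀ i → α i * pivot ≡ M (punchIn p i) Fin.zero
    α-pivot i = trans (ℚP.*-assoc (M (punchIn p i) Fin.zero) (1/ pivot) pivot)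
                      (trans (cong (M (punchIn p i) Fin.zero *_) (ℚP.*-inverseˡ pivot)) (ℚP.*-identityʳ _))

    eliminated : Fin (suc d) → Fin d → ℚ
    eliminated i j = M (punchIn p i) (Fin.suc j) - α i * M p (Fin.suc j)

    module Lift (c′ : Fin (suc d) → ℚ) where

      cₚ : ℚ
      cₚ = - ΣF (suc d) (λ i → c′ i * α i)

      c : Fin (suc (suc d)) → ℚ
      c q with p FinP.≟ q
      ... | yes _   = cₚ
      ... | no  p≢q = c′ (punchOut p≢q)

      c-p : c p ≡ cₚ
      c-p with p FinP.≟ p
      ... | yes _   = refl
      ... | no  p≢p = ⊥-elim (p≢p refl)

      c-punchIn : ∀ i → c (punchIn p i) ≡ c′ i
      c-punchIn i with p FinP.≟ punchIn p i
      ... | yes p≡ = ⊥-elim (FinP.punchInᵢ≢i p i (sym p≡))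
      ... | no  p≢ = cong c′ (FinP.punchOut-punchIn p)

      expand : ∀ j → ΣF (suc (suc d)) (λ q → c q * M q j) ≡ cₚ * M p j + ΣF (suc d) (λ i → c′ i * M (punchIn p i) j)
      expand j = trans (ΣF-punchIn (suc d) p (λ q → c q * M q j))
                       (cong₂ _+_ (cong (_* M p j) c-p) (ΣF-cong (suc d) (λ i → cong (_* M (punchIn p i) j) (c-punchIn i))))

      c-column₀ : ΣF (suc (suc d)) (λ q → c q * M q Fin.zero) ≡ 0ℚ
      c-column₀ = begin
        ΣF (suc (suc d)) (λ q → c q * M q Fin.zero)
          ≡⟨ expand Fin.zero ⟩
        cₚ * pivot + ΣF (suc d) (λ i → c′ i * M (punchIn p i) Fin.zero)
          ≡⟨ cong (cₚ * pivot +_) (ΣF-cong (suc d) (λ i → trans (cong (c′ i *_) (sym (α-pivot i))) (sym (ℚP.*-assoc (c′ i) (α i) pivot)))) ⟩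
        cₚ * pivot + ΣF (suc d) (λ i → (c′ i * α i) * pivot)
          ≡⟨ cong (cₚ * pivot +_) (ΣF-*ʳ (suc d) (λ i → c′ i * α i) pivot) ⟩
        cₚ * pivot + ΣF (suc d) (λ i → c′ i * α i) * pivot
          ≡⟨ solve 2 (λ S v → (:- S) :* v :+ S :* v := con 0ℚ) refl (ΣF (suc d) (λ i → c′ i * α i)) pivot ⟩
        0ℚ  ∎
        where open ≡-Reasoning

      c-column-suc : ∀ j → ΣF (suc d) (λ i → c′ i * eliminated i j) ≡ 0ℚ → ΣF (suc (suc d)) (λ q → c q * M q (Fin.suc j)) ≡ 0ℚ
      c-column-suc j c′-rel = begin
        ΣF (suc (suc d)) (λ q → c q * M q (Fin.suc j))
          ≡⟨ expand (Fin.suc j) ⟩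
        cₚ * m + ΣF (suc d) (λ i → c′ i * M (punchIn p i) (Fin.suc j))
          ≡⟨ cong (λ S → S * m + ΣF (suc d) (λ i → c′ i * M (punchIn p i) (Fin.suc j))) (ΣF-neg (suc d) (λ i → c′ i * α i)) ⟨
        ΣF (suc d) (λ i → - (c′ i * α i)) * m + ΣF (suc d) (λ i → c′ i * M (punchIn p i) (Fin.suc j))
          ≡⟨ cong (_+ ΣF (suc d) (λ i → c′ i * M (punchIn p i) (Fin.suc j))) (ΣF-*ʳ (suc d) (λ i → - (c′ i * α i)) m) ⟨
        ΣF (suc d) (λ i → - (c′ i * α i) * m) + ΣF (suc d) (λ i → c′ i * M (punchIn p i) (Fin.suc j))
          ≡⟨ ΣF-+ (suc d) (λ i → - (c′ i * α i) * m) (λ i → c′ i * M (punchIn p i) (Fin.suc j)) ⟨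
        ΣF (suc d) (λ i → - (c′ i * α i) * m + c′ i * M (punchIn p i) (Fin.suc j))
          ≡⟨ ΣF-cong (suc d) (λ i → solve 4 (λ c a m x → :- (c :* a) :* m :+ c :* x := c :* (x :- a :* m))
                                            refl (c′ i) (α i) m (M (punchIn p i) (Fin.suc j))) ⟩
        ΣF (suc d) (λ i → c′ i * eliminated i j)
          ≡⟨ c′-rel ⟩
        0ℚ  ∎
        where
        open ≡-Reasoning
        m : ℚ
        m = M p (Fin.suc j)

  relation-pivot : ∀ d (M : Fin (suc (suc d)) → Fin (suc d) → ℚ) p → M p Fin.zero ≢ 0ℚ →
                   (∀ M′ → NontrivialRelation (suc d) d M′) → NontrivialRelation (suc (suc d)) (suc d) M
  relation-pivot d M p pivot≢0 relation with relation (PivotElimination.eliminated M p pivot≢0)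
  ... | c′ , (i₀ , c′ᵢ₀≢0) , c′-rel =
    c , (punchIn p i₀ , λ cᵢ₀≡0 → c′ᵢ₀≢0 (trans (sym (c-punchIn i₀)) cᵢ₀≡0)) ,
    λ { Fin.zero → c-column₀ ; (Fin.suc j) → c-column-suc j (c′-rel j) }
    where open PivotElimination.Lift M p pivot≢0 c′

  rows-dependent : ∀ d (M : Fin (suc d) → Fin d → ℚ) → NontrivialRelation (suc d) d M
  rows-dependent zero    M = (λ _ → 1ℚ) , (Fin.zero , λ ()) , λ ()
  rows-dependent (suc d) M with FinP.any? (λ p → ¬? (M p Fin.zero ℚP.≟ 0ℚ))
  ... | yes (p , pivot≢0) = relation-pivot d M p pivot≢0 (rows-dependent d)
  ... | no  no-pivot      = relation-zeroColumn d M column₀≡0 (rows-dependent d (λ i j → M (Fin.suc i) (Fin.suc j)))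
    where
    column₀≡0 : ∀ p → M p Fin.zero ≡ 0ℚ
    column₀≡0 p with M p Fin.zero ℚP.≟ 0ℚ
    ... | yes eq = eq
    ... | no  ne = ⊥-elim (no-pivot (p , ne))

module Basis (n k : ℕ) where

  open import Data.Nat using (suc)
  open import Data.Fin as Fin using (Fin)
  import Data.Fin.Properties as FinP
  open import Data.Bool using (true; false)
  open import Data.List using (List; []; _∷_; length; lookup; allFin; foldr)
  open import Data.List.Membership.Propositional.Properties using (∈-lookup; ∈-allFin)
  import Data.List.Relation.Unary.All as All
  open import Data.List.Relation.Unary.Unique.Propositional.Properties using (allFin⁺)
  open import Data.Rational using (ℚ; 0ℚ; 1ℚ; _+_; _*_; -_; _-_)
  open import Data.Rational.Solver using (module +-*-Solver)
  open +-*-Solver using (solve; _:=_; _:+_; _:*_; _:-_)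
  open import Data.Product using (Σ-syntax; _,_; proj₁; proj₂)
  open import Data.Unit using (tt)
  open import Function using (_∘_; case_of_)
  open import Relation.Nullary using (¬_; yes; no; ⌊_⌋)
  open import Relation.Binary.PropositionalEquality
  open import Defs
  open ListLemmas
  open Words n
  open Coefficients n
  open Span n k
  open IdealIsSpan n k using (InIdeal⇒InSpan; InSpan⇒InIdeal)
  open Reduction n k
  open LinearDependence

  private
    Σl-neg : ∀ {X : Set} (f : X → ℚ) xs → Σl (λ x → - f x) xs ≡ - Σl f xs
    Σl-neg f []       = refl
    Σl-neg f (x ∷ xs) = trans (cong (- f x +_) (Σl-neg f xs)) (sym (ℚP.neg-distrib-+ (f x) _))

  standardWords : List (Word n)
  standardWords = filterB isStandard (allWords n k)

  dimension : ℕ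
  dimension = length standardWords

  standardWord : Fin dimension → Word n
  standardWord = lookup standardWords

  standardWord-length : ∀ j → length (standardWord j) ≡ k
  standardWord-length j = All.lookup (filterB-All isStandard (allWords-length k)) (∈-lookup j)

  standardWord-isStandard : ∀ j → isStandard (standardWord j) ≡ true
  standardWord-isStandard j = All.lookup (filterB-true isStandard (allWords n k)) (∈-lookup j)

  standardWord-injective : ∀ i j → standardWord i ≡ standardWord j → i ≡ j
  standardWord-injective = lookup-injective (filterB-unique isStandard (allWords-unique k))

  coeff-foldr-scale : ∀ {d} (c : Fin d → ℚ) (v : Fin d → Poly n) (F : Fin d → Poly n → Poly n) →
                      (∀ i acc → F i acc ≡ scale (c i) (v i) ⊕ acc) →
                      ∀ is w → coeff (foldr F [] is) w ≡ Σl (λ i → c i * coeff (v i) w) is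
  coeff-foldr-scale c v F F≡ []       w = refl
  coeff-foldr-scale c v F F≡ (i ∷ is) w = trans (cong (λ p → coeff p w) (F≡ i _))
    (trans (coeff-++ (scale (c i) (v i)) _ w) (cong₂ _+_ (coeff-scale (c i) (v i) w) (coeff-foldr-scale c v F F≡ is w)))

  coeff-linComb : ∀ {d} (c : Fin d → ℚ) (v : Fin d → Poly n) w → coeff (linComb c v) w ≡ ΣF d (λ i → c i * coeff (v i) w)
  coeff-linComb {d} c v w =
    trans (coeff-foldr-scale c v _ (λ _ _ → refl) (allFin d) w) (Σl-tabulate d (λ i → c i * coeff (v i) w) (λ i → i))

  Homog-linComb : ∀ {d} (c : Fin d → ℚ) (v : Fin d → Poly n) → (∀ i → Homog k (v i)) → Homog k (linComb c v)
  Homog-linComb {d} c v homog w len≢ = trans (coeff-linComb c v w)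
    (trans (ΣF-cong d (λ i → trans (cong (c i *_) (homog i w len≢)) (ℚP.*-zeroʳ (c i)))) (ΣF-zero d))

  monomial : Word n → Poly n
  monomial x = (1ℚ , x) ∷ []

  coeff-monomial : ∀ x w → coeff (monomial x) w ≡ δ x w
  coeff-monomial x w = ℚP.+-identityʳ (δ x w)

  standardWords-independent : IndepMod n k dimension (monomial ∘ standardWord)
  standardWords-independent = homog , independent
    where
    homog : ∀ j → Homog k (monomial (standardWord j))
    homog j w len≢ = trans (coeff-monomial (standardWord j) w) (δ-≢ (λ { refl → len≢ (standardWord-length j) }))
    independent : ∀ c → InIdeal n (linComb c (monomial ∘ standardWord)) → ∀ i → c i ≡ 0ℚ
    independent c inIdeal i = trans (sym at-standardWord)
      (InSpan-vanishing (InIdeal⇒InSpan (linComb c (monomial ∘ standardWord)) inIdeal) on-nonstandard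
                        (standardWord i) (standardWord-length i))
      where
      g : Word n → ℚ
      g = coeff (linComb c (monomial ∘ standardWord))
      g≡ : ∀ w → g w ≡ ΣF dimension (λ j → c j * δ (standardWord j) w)
      g≡ w = trans (coeff-linComb c _ w) (ΣF-cong dimension (λ j → cong (c j *_) (coeff-monomial (standardWord j) w)))
      on-nonstandard : ∀ x → length x ≡ k → isStandard x ≡ false → g x ≡ 0ℚ
      on-nonstandard x _ nonstd = trans (g≡ x) (trans (ΣF-cong dimension λ j →
        trans (cong (c j *_) (δ-≢ (λ { refl → case trans (sym (standardWord-isStandard j)) nonstd of λ () })))
              (ℚP.*-zeroʳ (c j))) (ΣF-zero dimension))
      at-standardWord : g (standardWord i) ≡ c i
      at-standardWord = begin
        g (standardWord i)                                                  ≡⟨ g≡ (standardWord i) ⟩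
        ΣF dimension (λ j → c j * δ (standardWord j) (standardWord i))      ≡⟨ ΣF-cong dimension pick ⟩
        ΣF dimension (λ j → [ ⌊ j FinP.≟ i ⌋ ]· c j)                         ≡⟨ Σl-tabulate dimension _ (λ j → j) ⟨
        Σl (λ j → [ ⌊ j FinP.≟ i ⌋ ]· c j) (allFin dimension)                ≡⟨ Σl-indicator FinP._≟_ c i (allFin⁺ dimension) (∈-allFin i) ⟩
        c i                                                                 ∎
        where
        open ≡-Reasoning
        pick : ∀ j → c j * δ (standardWord j) (standardWord i) ≡ [ ⌊ j FinP.≟ i ⌋ ]· c j
        pick j with j FinP.≟ i
        ... | yes refl = trans (cong (c j *_) (δ-refl (standardWord j))) (ℚP.*-identityʳ (c j))
        ... | no  j≢i  = trans (cong (c j *_) (δ-≢ (j≢i ∘ standardWord-injective j i))) (ℚP.*-zeroʳ (c j))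

  standardCombination-standardWords : ∀ f w →
    standardCombination f w ≡ ΣF dimension (λ j → f (standardWord j) * δ (standardWord j) w)
  standardCombination-standardWords f w =
    trans (sym (Σl-filterB isStandard (λ t → f t * δ t w) (allWords n k))) (Σl-lookup (λ t → f t * δ t w) standardWords)

  ΣW-δ : ∀ f w → length w ≡ k → ΣW k (λ x → f x * δ x w) ≡ f w
  ΣW-δ f w len = trans (ΣW-cong k (λ x _ → trans (ℚP.*-comm (f x) (δ x w)) (δ-* x w (f x)))) (ΣW-indicator f w len)

  reduced : ∀ (p : Poly n) → Σ[ B ∈ (Word n → ℚ) ] InSpan (λ w → coeff p w - standardCombination B w)
  reduced p = B , InSpan-cong rearrange (InSpan-ΣW k (λ x w → coeff p x * (δ x w - standardCombination (b x) w))
                                                    (λ x _ → InSpan-* (coeff p x) (proj₂ (reduces x))))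
    where
    b : Word n → Word n → ℚ
    b x = proj₁ (reduces x)
    B : Word n → ℚ
    B t = ΣW k (λ x → coeff p x * b x t)
    rearrange : ∀ w → length w ≡ k → ΣW k (λ x → coeff p x * (δ x w - standardCombination (b x) w)) ≡ coeff p w - standardCombination B w
    rearrange w len = begin
      ΣW k (λ x → coeff p x * (δ x w - standardCombination (b x) w))
        ≡⟨ ΣW-cong k (λ x _ → ℚP.*-distribˡ-+ (coeff p x) (δ x w) _) ⟩
      ΣW k (λ x → coeff p x * δ x w + coeff p x * - standardCombination (b x) w)
        ≡⟨ Σl-+ _ _ (allWords n k) ⟩
      ΣW k (λ x → coeff p x * δ x w) + ΣW k (λ x → coeff p x * - standardCombination (b x) w)
        ≡⟨ cong₂ _+_ (ΣW-δ (coeff p) w len)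
                     (trans (ΣW-cong k (λ x _ → sym (ℚP.neg-distribʳ-* (coeff p x) _))) (Σl-neg _ (allWords n k))) ⟩
      coeff p w - ΣW k (λ x → coeff p x * standardCombination (b x) w)
        ≡⟨ cong (λ y → coeff p w - y) (standardCombination-Σl (allWords n k) (coeff p) b w) ⟨
      coeff p w - standardCombination B w  ∎
      where open ≡-Reasoning

  InSpan-linComb : ∀ {r} (c : Fin r → ℚ) (v : Fin r → Poly n) (B : Fin r → Word n → ℚ) →
                   (∀ i → InSpan (λ w → coeff (v i) w - standardCombination (B i) w)) →
                   (∀ j → ΣF r (λ i → c i * B i (standardWord j)) ≡ 0ℚ) →
                   InSpan (coeff (linComb c v))
  InSpan-linComb {r} c v B reduced∈ standard-cancel = InSpan-cong (λ w _ → coeff≡ w)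
    (InSpan-Σl _ (All.universal (λ _ → tt) (allFin r)) (λ i _ → InSpan-* (c i) (reduced∈ i)))
    where
    open ≡-Reasoning
    X S : Fin r → Word n → ℚ
    X i w = c i * (coeff (v i) w - standardCombination (B i) w)
    S i w = c i * standardCombination (B i) w
    standardPart≡0 : ∀ w → ΣF r (λ i → S i w) ≡ 0ℚ
    standardPart≡0 w = begin
      ΣF r (λ i → S i w)
        ≡⟨ Σl-tabulate r (λ i → S i w) (λ i → i) ⟨
      Σl (λ i → c i * standardCombination (B i) w) (allFin r)
        ≡⟨ standardCombination-Σl (allFin r) c B w ⟨
      standardCombination (λ t → Σl (λ i → c i * B i t) (allFin r)) w
        ≡⟨ standardCombination-standardWords (λ t → Σl (λ i → c i * B i t) (allFin r)) w ⟩
      ΣF dimension (λ j → Σl (λ i → c i * B i (standardWord j)) (allFin r) * δ (standardWord j) w)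
        ≡⟨ ΣF-cong dimension (λ j → trans (cong (_* δ (standardWord j) w)
                                                (trans (Σl-tabulate r (λ i → c i * B i (standardWord j)) (λ i → i)) (standard-cancel j)))
                                          (ℚP.*-zeroˡ (δ (standardWord j) w))) ⟩
      ΣF dimension (λ _ → 0ℚ)
        ≡⟨ ΣF-zero dimension ⟩
      0ℚ  ∎
    coeff≡ : ∀ w → Σl (λ i → X i w) (allFin r) ≡ coeff (linComb c v) w
    coeff≡ w = begin
      Σl (λ i → X i w) (allFin r)                        ≡⟨ Σl-tabulate r (λ i → X i w) (λ i → i) ⟩
      ΣF r (λ i → X i w)                                 ≡⟨ ℚP.+-identityʳ _ ⟨
      ΣF r (λ i → X i w) + 0ℚ                            ≡⟨ cong (ΣF r (λ i → X i w) +_) (standardPart≡0 w) ⟨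
      ΣF r (λ i → X i w) + ΣF r (λ i → S i w)            ≡⟨ ΣF-+ r (λ i → X i w) (λ i → S i w) ⟨
      ΣF r (λ i → X i w + S i w)
        ≡⟨ ΣF-cong r (λ i → solve 3 (λ a x t → a :* (x :- t) :+ a :* t := a :* x) refl (c i) (coeff (v i) w) (standardCombination (B i) w)) ⟩
      ΣF r (λ i → c i * coeff (v i) w)                   ≡⟨ coeff-linComb c v w ⟨
      coeff (linComb c v) w                              ∎

  larger-families-dependent : ∀ (v : Fin (suc dimension) → Poly n) → ¬ IndepMod n k (suc dimension) v
  larger-families-dependent v (homog , independent)
    with rows-dependent dimension (λ i j → proj₁ (reduced (v i)) (standardWord j))
  ... | c , (i₀ , cᵢ₀≢0) , standard-cancel = cᵢ₀≢0 (independent c inIdeal i₀)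
    where
    inIdeal : InIdeal n (linComb c v)
    inIdeal = InSpan⇒InIdeal (linComb c v) (Homog-linComb c v homog)
                (InSpan-linComb c v (λ i → proj₁ (reduced (v i))) (λ i → proj₂ (reduced (v i))) standard-cancel)

  dimension-correct : HasDim n k dimension
  dimension-correct = (monomial ∘ standardWord , standardWords-independent) , larger-families-dependent

module ℕSums = Sums ℕP.+-*-isCommutativeSemiring

module Counting (n : ℕ) where

  open import Data.Nat using (zero; suc; _≤_; _<_; _+_; _*_; _^_; _∸_; _≟_; z≤n; s≤s)
  open import Data.Nat.Properties
  open import Data.Fin as Fin using (fromℕ<)
  import Data.Fin.Properties as FinP
  open import Data.Bool using (Bool; true; false)
  open import Data.List using (List; []; _∷_; _++_; length)
  open import Data.List.Properties using (≡-dec)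
  open import Data.List.Membership.DecPropositional (≡-dec _≟_) using (_∈_; _∈?_)
  import Data.List.Relation.Unary.All as All
  open import Data.List.Relation.Unary.All.Properties using (¬Any⇒All¬)
  open import Data.Product using (Σ-syntax; _,_; proj₁; proj₂)
  open import Function.Bundles using (_⇔_; mk⇔; Equivalence)
  open import Relation.Nullary using (Dec; yes; no; does; ⌊_⌋)
  open import Relation.Nullary.Decidable using (dec-true; dec-false; does-⇔; isYes≗does)
  open import Relation.Binary.Definitions using (DecidableEquality)
  open import Relation.Binary.PropositionalEquality
  open import Defs
  open Patterns
  open Words n
  open ℕSums
  open WordSums n

  private
    ⌊⌋-⇔ : ∀ {A B : Set} → A ⇔ B → (a? : Dec A) (b? : Dec B) → ⌊ a? ⌋ ≡ ⌊ b? ⌋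
    ⌊⌋-⇔ A⇔B a? b? = trans (isYes≗does a?) (trans (does-⇔ A⇔B a? b?) (sym (isYes≗does b?)))

  length-filterB : ∀ {X : Set} (q : X → Bool) xs → length (filterB q xs) ≡ Σl (λ x → [ q x ]· 1) xs
  length-filterB q []       = refl
  length-filterB q (x ∷ xs) with q x
  ... | true  = cong suc (length-filterB q xs)
  ... | false = length-filterB q xs

  length≡Σl : ∀ {X : Set} (xs : List X) → length xs ≡ Σl (λ _ → 1) xs
  length≡Σl []       = refl
  length≡Σl (_ ∷ xs) = cong suc (length≡Σl xs)

  ΣW-const : ∀ m c → ΣW m (λ _ → c) ≡ n ^ m * c
  ΣW-const zero    c = refl
  ΣW-const (suc m) c = begin
    ΣW (suc m) (λ _ → c)          ≡⟨ ΣW-suc m (λ _ → c) ⟩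
    ΣW m (λ _ → ΣF n (λ _ → c))   ≡⟨ ΣW-const m (ΣF n (λ _ → c)) ⟩
    n ^ m * ΣF n (λ _ → c)        ≡⟨ cong (n ^ m *_) (ΣF-const n) ⟩
    n ^ m * (n * c)               ≡⟨ *-assoc (n ^ m) n c ⟨
    n ^ m * n * c                 ≡⟨ cong (_* c) (*-comm (n ^ m) n) ⟩
    n * n ^ m * c                 ∎
    where
    open ≡-Reasoning
    ΣF-const : ∀ l → ΣF l (λ _ → c) ≡ l * c
    ΣF-const zero    = refl
    ΣF-const (suc l) = cong (c +_) (ΣF-const l)

  sum1to-cong : ∀ K (f g : ℕ → ℕ) → (∀ i → 1 ≤ i → i ≤ K → f i ≡ g i) → sum1to K f ≡ sum1to K g
  sum1to-cong zero    f g f≗g = refl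
  sum1to-cong (suc K) f g f≗g =
    cong₂ _+_ (sum1to-cong K f g (λ i 1≤i i≤K → f≗g i 1≤i (m≤n⇒m≤1+n i≤K))) (f≗g (suc K) (s≤s z≤n) ≤-refl)

  Σl-sum1to : ∀ {X : Set} K (f : X → ℕ → ℕ) xs → Σl (λ x → sum1to K (f x)) xs ≡ sum1to K (λ i → Σl (λ x → f x i) xs)
  Σl-sum1to zero    f xs = Σl-zero xs
  Σl-sum1to (suc K) f xs =
    trans (Σl-+ (λ x → sum1to K (f x)) (λ x → f x (suc K)) xs) (cong (_+ Σl (λ x → f x (suc K)) xs) (Σl-sum1to K f xs))

  sum1to-above : ∀ K s → K < s → sum1to K (λ i → [ does (s ≟ i) ]· 1) ≡ 0
  sum1to-above zero    s _   = refl
  sum1to-above (suc K) s K<s = cong₂ _+_ (sum1to-above K s (<-trans (n<1+n K) K<s))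
                                         (cong ([_]· 1) (dec-false (s ≟ suc K) (λ s≡ → <-irrefl (sym s≡) K<s)))

  sum1to-indicator : ∀ K s → 1 ≤ s → s ≤ K → sum1to K (λ i → [ does (s ≟ i) ]· 1) ≡ 1
  sum1to-indicator zero    (suc s) _ ()
  sum1to-indicator (suc K) s 1≤s s≤1+K with s ≟ suc K
  ... | yes refl = cong₂ _+_ (sum1to-above K (suc K) (n<1+n K)) (cong ([_]· 1) (dec-true (suc K ≟ suc K) refl))
  ... | no  s≢   = cong₂ _+_ (sum1to-indicator K s 1≤s (≤-pred (≤∧≢⇒< s≤1+K s≢))) (cong ([_]· 1) (dec-false (s ≟ suc K) s≢))

  sum1to-indicator-0 : ∀ K → sum1to K (λ i → [ does (0 ≟ i) ]· 1) ≡ 0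
  sum1to-indicator-0 zero    = refl
  sum1to-indicator-0 (suc K) = trans (+-identityʳ _) (sum1to-indicator-0 K)

  one-class : ∀ k x → length x ≡ k → [ isStandard x ]· 1 + sum1to k (λ i → [ does (tailLength x ≟ i) ]· 1) ≡ 1
  one-class k x len with tailLength x | rgsTail-≤ (labels x)
  ... | zero  | _       = cong suc (sum1to-indicator-0 k)
  ... | suc t | t<len   = sum1to-indicator k (suc t) (s≤s z≤n) (subst (suc t ≤_) (trans (length-labels x) len) t<len)

  tailLength-++ : ∀ u a i → 1 ≤ i → length a ≡ i → does (tailLength (u ++ a) ≟ i) ≡ does (tailLength a ≟ i)
  tailLength-++ u a i 1≤i len = does-⇔ (mk⇔ to from) (tailLength (u ++ a) ≟ i) (tailLength a ≟ i)
    where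
    labels≡ : labels (u ++ a) ≡ labels u ++ labels a
    labels≡ = labels-++ u a
    len′ : length (labels a) ≡ i
    len′ = trans (length-labels a) len
    to : tailLength (u ++ a) ≡ i → tailLength a ≡ i
    to eq = trans (rgsTail-++-full (labels u) (labels a) (trans (sym (cong rgsTail labels≡)) (trans eq (sym len′)))) len′
    from : tailLength a ≡ i → tailLength (u ++ a) ≡ i
    from eq = trans (cong rgsTail labels≡) (trans (rgsTail-++ (labels u) (λ tail≡0 → <⇒≢ 1≤i (sym (trans (sym eq) tail≡0)))) eq)

  ΣW-tailLength : ∀ k i → 1 ≤ i → i ≤ k →
                  ΣW k (λ x → [ does (tailLength x ≟ i) ]· 1) ≡ n ^ (k ∸ i) * ΣW i (λ a → [ does (tailLength a ≟ i) ]· 1)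
  ΣW-tailLength k i 1≤i i≤k = begin
    ΣW k (λ x → [ does (tailLength x ≟ i) ]· 1)
      ≡⟨ cong (λ l → ΣW l (λ x → [ does (tailLength x ≟ i) ]· 1)) (m∸n+n≡m i≤k) ⟨
    ΣW (k ∸ i + i) (λ x → [ does (tailLength x ≟ i) ]· 1)
      ≡⟨ ΣW-split (k ∸ i) i _ ⟩
    ΣW (k ∸ i) (λ u → ΣW i (λ a → [ does (tailLength (u ++ a) ≟ i) ]· 1))
      ≡⟨ ΣW-cong (k ∸ i) (λ u _ → ΣW-cong i (λ a len → cong ([_]· 1) (tailLength-++ u a i 1≤i len))) ⟩
    ΣW (k ∸ i) (λ _ → ΣW i (λ a → [ does (tailLength a ≟ i) ]· 1))
      ≡⟨ ΣW-const (k ∸ i) _ ⟩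
    n ^ (k ∸ i) * ΣW i (λ a → [ does (tailLength a ≟ i) ]· 1)  ∎
    where open ≡-Reasoning

  numBlocks-labels : ∀ a → numBlocks (labels a) ≤ n
  numBlocks-labels []      = z≤n
  numBlocks-labels (x ∷ a) = ⊔-lub (FinP.toℕ<n x) (numBlocks-labels a)

  word-with-labels : ∀ A → numBlocks A ≤ n → Σ[ a ∈ Word n ] labels a ≡ A
  word-with-labels []      _  = [] , refl
  word-with-labels (x ∷ A) nb =
    let a , labels≡ = word-with-labels A (≤-trans (m≤n⊔m (suc x) (numBlocks A)) nb) in
    fromℕ< (≤-trans (m≤m⊔n (suc x) (numBlocks A)) nb) ∷ a , cong₂ _∷_ (FinP.toℕ-fromℕ< _) labels≡

  tailLength-full⇔NSP : ∀ i a → 1 ≤ i → length a ≡ i → (tailLength a ≡ i ⇔ NSP n i (labels a))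
  tailLength-full⇔NSP i a 1≤i len = mk⇔
    (λ eq → rgsTail-full⇒nonsplitable (labels a) (subst (1 ≤_) (sym len′) 1≤i) (trans eq (sym len′)) , len′ , numBlocks-labels a)
    (λ (nonsplit , _ , _) → trans (nonsplitable⇒rgsTail-full (labels a) nonsplit) len′)
    where
    len′ : length (labels a) ≡ i
    len′ = trans (length-labels a) len

  ΣW-nonsplitable : ∀ i c → 1 ≤ i → HasCount (NSP n i) c → ΣW i (λ a → [ does (tailLength a ≟ i) ]· 1) ≡ c
  ΣW-nonsplitable i c 1≤i (L , unique , len-L , L⇔) = begin
    ΣW i (λ a → [ does (tailLength a ≟ i) ]· 1)
      ≡⟨ ΣW-cong i (λ a len → cong ([_]· 1) (does-⇔ (∈L⇔ a len) (tailLength a ≟ i) (labels a ∈? L))) ⟩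
    ΣW i (λ a → [ does (labels a ∈? L) ]· 1)
      ≡⟨ ΣW-cong i (λ a _ → sym (count-membership (labels a))) ⟩
    ΣW i (λ a → Σl (λ A → [ ⌊ A ≟ₗ labels a ⌋ ]· 1) L)
      ≡⟨ Σl-swap (λ a A → [ ⌊ A ≟ₗ labels a ⌋ ]· 1) (allWords n i) L ⟩
    Σl (λ A → ΣW i (λ a → [ ⌊ A ≟ₗ labels a ⌋ ]· 1)) L
      ≡⟨ Σl-congAll (All.tabulate (λ {A} A∈L → one-word A (proj₁ (L⇔ A) A∈L))) ⟩
    Σl (λ _ → 1) L
      ≡⟨ length≡Σl L ⟨
    length L
      ≡⟨ len-L ⟩
    c  ∎
    where
    open ≡-Reasoning
    _≟ₗ_ : DecidableEquality (List ℕ)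
    _≟ₗ_ = ≡-dec _≟_
    ∈L⇔ : ∀ a → length a ≡ i → (tailLength a ≡ i ⇔ labels a ∈ L)
    ∈L⇔ a len = mk⇔ (λ eq → proj₂ (L⇔ (labels a)) (Equivalence.to (tailLength-full⇔NSP i a 1≤i len) eq))
                     (λ a∈L → Equivalence.from (tailLength-full⇔NSP i a 1≤i len) (proj₁ (L⇔ (labels a)) a∈L))
    count-membership : ∀ B → Σl (λ A → [ ⌊ A ≟ₗ B ⌋ ]· 1) L ≡ [ does (B ∈? L) ]· 1
    count-membership B with B ∈? L
    ... | yes B∈L = Σl-indicator _≟ₗ_ (λ _ → 1) B unique B∈L
    ... | no  B∉L = Σl-indicator-∉ _≟ₗ_ (λ _ → 1) B (¬Any⇒All¬ L B∉L)
    one-word : ∀ A → NSP n i A → ΣW i (λ a → [ ⌊ A ≟ₗ labels a ⌋ ]· 1) ≡ 1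
    one-word A (_ , len-A , nb) with word-with-labels A nb
    ... | a₀ , labels≡ = trans (ΣW-cong i (λ a _ → cong ([_]· 1) (⌊⌋-⇔ (mk⇔ to from) (A ≟ₗ labels a) (a ≟ʷ a₀))))
                               (ΣW-indicator (λ _ → 1) a₀ (trans (sym (length-labels a₀)) (trans (cong length labels≡) len-A)))
      where
      to : ∀ {a} → A ≡ labels a → a ≡ a₀
      to A≡ = labels-injective (trans (sym A≡) (sym labels≡))
      from : ∀ {a} → a ≡ a₀ → A ≡ labels a
      from refl = sym labels≡

  standard-count : ∀ k (w : ℕ → ℕ) → (∀ i → 1 ≤ i → i ≤ k → HasCount (NSP n i) (w i)) →
                   length (filterB isStandard (allWords n k)) + sum1to k (λ i → w i * n ^ (k ∸ i)) ≡ n ^ k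
  standard-count k w counts = sym (begin
    n ^ k
      ≡⟨ trans (sym (*-identityʳ (n ^ k))) (sym (ΣW-const k 1)) ⟩
    ΣW k (λ _ → 1)
      ≡⟨ ΣW-cong k (λ x len → sym (one-class k x len)) ⟩
    ΣW k (λ x → [ isStandard x ]· 1 + sum1to k (λ i → [ does (tailLength x ≟ i) ]· 1))
      ≡⟨ Σl-+ _ _ (allWords n k) ⟩
    ΣW k (λ x → [ isStandard x ]· 1) + ΣW k (λ x → sum1to k (λ i → [ does (tailLength x ≟ i) ]· 1))
      ≡⟨ cong₂ _+_ (sym (length-filterB isStandard (allWords n k))) (Σl-sum1to k _ (allWords n k)) ⟩
    length (filterB isStandard (allWords n k)) + sum1to k (λ i → ΣW k (λ x → [ does (tailLength x ≟ i) ]· 1))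
      ≡⟨ cong (length (filterB isStandard (allWords n k)) +_) (sum1to-cong k _ _ λ i 1≤i i≤k →
           trans (ΣW-tailLength k i 1≤i i≤k)
                 (trans (cong (n ^ (k ∸ i) *_) (ΣW-nonsplitable i (w i) 1≤i (counts i 1≤i i≤k))) (*-comm (n ^ (k ∸ i)) (w i)))) ⟩
    length (filterB isStandard (allWords n k)) + sum1to k (λ i → w i * n ^ (k ∸ i))  ∎)
    where open ≡-Reasoning

open import Defs using (HasCount; NSP; HasDim; sum1to)
open import Data.Nat using (_≤_; _+_; _^_; _∸_; _*_)
open import Data.Nat.Properties using (m+n∸n≡m; m≤n+m)
open import Data.Integer using (+_; _-_; _⊖_)
open import Data.Integer.Properties using (m-n≡m⊖n; ⊖-≥)
open import Data.Product using (Σ-syntax; _×_; _,_)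
open import Relation.Binary.PropositionalEquality using (cong; module ≡-Reasoning)

mainTheorem10 : (n k : ℕ) → 1 ≤ n →
    (w : ℕ → ℕ) → (∀ i → 1 ≤ i → i ≤ k → HasCount (NSP n i) (w i)) →
    Σ[ d ∈ ℕ ] (HasDim n k d ×
      (+ d ≡ + (n ^ k) - + sum1to k (λ i → w i * n ^ (k ∸ i))))
mainTheorem10 n k _ w counts = dimension , dimension-correct , dimension-formula
  where
  open Basis n k
  open ≡-Reasoning
  S : ℕ
  S = sum1to k (λ i → w i * n ^ (k ∸ i))
  dimension-formula : + dimension ≡ + (n ^ k) - + S
  dimension-formula = begin
    + dimension                  ≡⟨ cong +_ (m+n∸n≡m dimension S) ⟨
    + (dimension + S ∸ S)        ≡⟨ ⊖-≥ (m≤n+m S dimension) ⟨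
    (dimension + S) ⊖ S          ≡⟨ m-n≡m⊖n (dimension + S) S ⟨
    + (dimension + S) - + S      ≡⟨ cong (λ m → + m - + S) (Counting.standard-count n k w counts) ⟩
    + (n ^ k) - + S              ∎
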